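{- Define $$Q_1=\Big\{\begin{pmatrix}1&0&a\\0&1&b\\0&0&t\end{pmatrix}: a,b\in\mathbb{F}_q\Big\},\ R_1=\Big\{\begin{pmatrix}1&a&0\\0&0&1\\0&t&0\end{pmatrix}: a\in\mathbb{F}_q\Big\},\ S_1=\Big\{\begin{pmatrix}0&1&0\\0&0&1\\t&0&0\end{pmatrix}\Big\},$$ $$Q_2=\Big\{\begin{pmatrix}1&a&b\\0&t&0\\0&0&t\end{pmatrix}: a,b\in\mathbb{F}_q\Big\},\ R_2=\Big\{\begin{pmatrix}0&1&a\\t&0&0\\0&0&t\end{pmatrix}: a\in\mathbb{F}_q\Big\},\ S_2=\Big\{\begin{pmatrix}0&0&1\\t&0&0\\0&t&0\end{pmatrix}\Big\}.$$ Then: $Q_1$ is a set of representatives of the right cosets $\Gamma\backslash\Gamma\delta_1\Gamma$ for each $\Gamma\in\{\Gamma_1(t),\Gamma_0(t),\Gamma^P_0\}$; $Q_2$ is a set of representatives of $\Gamma\backslash\Gamma\delta_2\Gamma$ for each $\Gamma\in\{\Gamma_1(t),\Gamma_0(t),\Gamma^P_2\}$; $Q_1\cup R_1$ is a set of representatives of $\Gamma^P_2\backslash\Gamma^P_2\delta_1\Gamma^P_2$; $Q_2\cup R_2$ is a set of representatives of $\Gamma^P_0\backslash\Gamma^P_0\delta_2\Gamma^P_0$; $Q_1\cup R_1\cup S_1$ is a set of representatives of $\mathrm{GL}_3(A)\backslash\mathrm{GL}_3(A)\delta_1\mathrm{GL}_3(A)$; and $Q_2\cup R_2\cup S_2$ is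 a set of representatives of $\mathrm{GL}_3(A)\backslash\mathrm{GL}_3(A)\delta_2\mathrm{GL}_3(A)$.
   Context: Let $q$ be a prime power, $A=\mathbb{F}_q[t]$, $\mathrm{pr}:\mathrm{GL}_3(A)\to\mathrm{GL}_3(\mathbb{F}_q)$ reduction mod $t$. $\delta_1=\mathrm{diag}(1,1,t)$, $\delta_2=\mathrm{diag}(1,t,t)\in\mathrm{GL}_3(\mathbb{F}_q(t))$. $\Gamma_1(t)=\mathrm{pr}^{ -1}(U)$ with $U$ the upper triangular unipotent matrices, $\Gamma_0(t)=\mathrm{pr}^{ -1}(B)$ with $B$ the invertible upper triangular matrices, $\Gamma^P_0=\mathrm{pr}^{ -1}(P_0)$ with $P_0=\{(a_{ij}):a_{31}=a_{32}=0\}$, $\Gamma^P_2=\mathrm{pr}^{ -1}(P_2)$ with $P_2=\{(a_{ij}):a_{21}=a_{31}=0\}$ (all in $\mathrm{GL}_3(\mathbb{F}_q)$). For a group $\Gamma$ and $\delta$, $\Gamma\backslash\Gamma\delta\Gamma$ denotes the set of cosets $\Gamma\xi$, $\xi\in\Gamma\delta\Gamma$; a set of representatives is a set containing exactly one element of each such coset. -}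

module Defs where

open import Level using (Level; _⊔_)
open import Data.Nat using (ℕ)
open import Data.Unit using (⊤)
open import Data.Fin using (Fin; zero; suc)
open import Data.List using (List; []; _∷_)
open import Data.List.Relation.Unary.Any using (Any)
open import Data.Product using (Σ; ∃; ∃-syntax; _×_; _,_)
open import Data.Sum using (_⊎_)
open import Relation.Nullary using (¬_)
open import Relation.Binary.Definitions using (Decidable)
open import Algebra.Bundles using (CommutativeRing)

record FiniteField (c ℓ : Level) : Set (Level.suc (c ⊔ ℓ)) where
  field
    commRing  : CommutativeRing c ℓ
  open CommutativeRing commRing public
  field
    1≉0       : ¬ (1# ≈ 0#)
    inverse   : ∀ x → ¬ (x ≈ 0#) → ∃[ y ] (x * y ≈ 1#)
    _≟_       : Decidable _≈_
    elements  : List Carrier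
    complete  : ∀ x → Any (x ≈_) elements

module GL3 {c ℓ} (F : FiniteField c ℓ) where
  open FiniteField F using (Carrier; _≈_; _+_; _*_; 0#; 1#)

  -- A = F_q[t] : polynomials as coefficient lists (constant term first)
  Poly : Set c
  Poly = List Carrier

  -- equality of polynomials (trailing zero coefficients are ignored)
  infix 4 _≈ₚ_
  _≈ₚ_ : Poly → Poly → Set ℓ
  []       ≈ₚ []       = Level.Lift ℓ ⊤
  []       ≈ₚ (y ∷ ys) = (y ≈ 0#) × ([] ≈ₚ ys)
  (x ∷ xs) ≈ₚ []       = (x ≈ 0#) × (xs ≈ₚ [])
  (x ∷ xs) ≈ₚ (y ∷ ys) = (x ≈ y) × (xs ≈ₚ ys)

  infixl 6 _+ₚ_
  _+ₚ_ : Poly → Poly → Poly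
  []       +ₚ ys       = ys
  (x ∷ xs) +ₚ []       = x ∷ xs
  (x ∷ xs) +ₚ (y ∷ ys) = (x + y) ∷ (xs +ₚ ys)

  scale : Carrier → Poly → Poly
  scale a []       = []
  scale a (x ∷ xs) = (a * x) ∷ scale a xs

  infixl 7 _*ₚ_
  _*ₚ_ : Poly → Poly → Poly
  []       *ₚ ys = []
  (x ∷ xs) *ₚ ys = scale x ys +ₚ (0# ∷ (xs *ₚ ys))

  const : Carrier → Poly
  const a = a ∷ []

  0ₚ 1ₚ tₚ : Poly
  0ₚ = []
  1ₚ = const 1#
  tₚ = 0# ∷ 1# ∷ []

  -- reduction mod t : the constant coefficient
  red : Poly → Carrier
  red []      = 0#
  red (x ∷ _) = x

  Mat : Set c
  Mat = Fin 3 → Fin 3 → Poly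

  infix 4 _≈ₘ_
  _≈ₘ_ : Mat → Mat → Set ℓ
  M ≈ₘ N = ∀ i j → M i j ≈ₚ N i j

  infixl 7 _·_
  _·_ : Mat → Mat → Mat
  (M · N) i j = M i zero *ₚ N zero j
             +ₚ M i (suc zero) *ₚ N (suc zero) j
             +ₚ M i (suc (suc zero)) *ₚ N (suc (suc zero)) j

  I₃ : Mat
  I₃ zero           zero           = 1ₚ
  I₃ (suc zero)     (suc zero)     = 1ₚ
  I₃ (suc (suc zero)) (suc (suc zero)) = 1ₚ
  I₃ _ _ = 0ₚ

  mat : Poly → Poly → Poly → Poly → Poly → Poly → Poly → Poly → Poly → Mat
  mat a b c' d e f g h k zero             zero             = a
  mat a b c' d e f g h k zero             (suc zero)       = b
  mat a b c' d e f g h k zero             (suc (suc zero)) = c'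
  mat a b c' d e f g h k (suc zero)       zero             = d
  mat a b c' d e f g h k (suc zero)       (suc zero)       = e
  mat a b c' d e f g h k (suc zero)       (suc (suc zero)) = f
  mat a b c' d e f g h k (suc (suc zero)) zero             = g
  mat a b c' d e f g h k (suc (suc zero)) (suc zero)       = h
  mat a b c' d e f g h k (suc (suc zero)) (suc (suc zero)) = k

  GL3A : Mat → Set (c ⊔ ℓ)
  GL3A M = ∃[ N ] ((M · N ≈ₘ I₃) × (N · M ≈ₘ I₃))

  -- positions (i,j) written with indices 1..3 in the paper
  i1 i2 i3 : Fin 3
  i1 = zero
  i2 = suc zero
  i3 = suc (suc zero)

  Γ₁ : Mat → Set (c ⊔ ℓ)
  Γ₁ M = GL3A M
       × (red (M i2 i1) ≈ 0#) × (red (M i3 i1) ≈ 0#) × (red (M i3 i2) ≈ 0#)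
       × (red (M i1 i1) ≈ 1#) × (red (M i2 i2) ≈ 1#) × (red (M i3 i3) ≈ 1#)

  -- Γ₀(t) = pr⁻¹(B), B = invertible upper triangular
  -- (invertibility of pr M is automatic since M ∈ GL_3(A))
  Γ₀ : Mat → Set (c ⊔ ℓ)
  Γ₀ M = GL3A M
       × (red (M i2 i1) ≈ 0#) × (red (M i3 i1) ≈ 0#) × (red (M i3 i2) ≈ 0#)

  ΓP₀ : Mat → Set (c ⊔ ℓ)
  ΓP₀ M = GL3A M × (red (M i3 i1) ≈ 0#) × (red (M i3 i2) ≈ 0#)

  ΓP₂ : Mat → Set (c ⊔ ℓ)
  ΓP₂ M = GL3A M × (red (M i2 i1) ≈ 0#) × (red (M i3 i1) ≈ 0#)

  δ₁ δ₂ : Mat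
  δ₁ = mat 1ₚ 0ₚ 0ₚ  0ₚ 1ₚ 0ₚ  0ₚ 0ₚ tₚ
  δ₂ = mat 1ₚ 0ₚ 0ₚ  0ₚ tₚ 0ₚ  0ₚ 0ₚ tₚ

  DoubleCoset : (Mat → Set (c ⊔ ℓ)) → Mat → Mat → Set (c ⊔ ℓ)
  DoubleCoset Γ δ ξ = ∃[ γ ] ∃[ γ' ] (Γ γ × Γ γ' × (ξ ≈ₘ γ · δ · γ'))

  record IsRepSet (Γ : Mat → Set (c ⊔ ℓ)) (δ : Mat)
                  (S : Mat → Set (c ⊔ ℓ)) : Set (Level.suc (c ⊔ ℓ)) where
    field
      inside : ∀ s → S s → DoubleCoset Γ δ s
      cover  : ∀ ξ → DoubleCoset Γ δ ξ →
               ∃[ s ] (S s × ∃[ γ ] (Γ γ × (ξ ≈ₘ γ · s)))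
      unique : ∀ s s' → S s → S s' → ∀ γ → Γ γ → s' ≈ₘ γ · s → s ≈ₘ s'

  _∪_ : (Mat → Set (c ⊔ ℓ)) → (Mat → Set (c ⊔ ℓ)) → Mat → Set (c ⊔ ℓ)
  (S ∪ T) M = S M ⊎ T M

  Q₁ R₁ S₁ Q₂ R₂ S₂ : Mat → Set (c ⊔ ℓ)
  Q₁ M = ∃[ a ] ∃[ b ] (M ≈ₘ mat 1ₚ 0ₚ (const a)  0ₚ 1ₚ (const b)  0ₚ 0ₚ tₚ)
  R₁ M = ∃[ a ] (M ≈ₘ mat 1ₚ (const a) 0ₚ  0ₚ 0ₚ 1ₚ  0ₚ tₚ 0ₚ)
  S₁ M = Level.Lift c (M ≈ₘ mat 0ₚ 1ₚ 0ₚ  0ₚ 0ₚ 1ₚ  tₚ 0ₚ 0ₚ)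
  Q₂ M = ∃[ a ] ∃[ b ] (M ≈ₘ mat 1ₚ (const a) (const b)  0ₚ tₚ 0ₚ  0ₚ 0ₚ tₚ)
  R₂ M = ∃[ a ] (M ≈ₘ mat 0ₚ 1ₚ (const a)  tₚ 0ₚ 0ₚ  0ₚ 0ₚ tₚ)
  S₂ M = Level.Lift c (M ≈ₘ mat 0ₚ 0ₚ 1ₚ  tₚ 0ₚ 0ₚ  0ₚ tₚ 0ₚ)

-- Every proposed representative is s = δ·g with g ∈ GL₃(F_q) a constant matrix.
--
-- For γ′ ∈ Γ choose g so that M = γ′g⁻¹ vanishes mod t at the entries which conjugation by δ
-- divides by t.  The same holds for M⁻¹, so h = δMδ⁻¹ and δM⁻¹δ⁻¹ are mutually inverse matrices over A, and
-- δγ′ = h·s.  Moreover h ∈ Γ: M ∈ Γ because g⁻¹ ∈ Γ, and none of the congruences defining Γ involves an entry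
-- that gets divided by t.  For δ₁ the matrix g is dictated by the line spanned by the last column of γ′⁻¹ mod t,
-- for δ₂ by the line spanned by the first row of γ′ mod t; writing that point of P²(F_q) in normal form gives
-- the families Q, R, S, and the congruences defining Γ decide which normal forms can occur.
--
-- Uniqueness.  If s′ = γs then every vector killed by s mod t is killed by s′ mod t, and these kernels
-- already tell the representatives apart.

module Submission where

open import Level using (Level; Lift; lift; _⊔_)
open import Data.Bool using (Bool; true; false; if_then_else_)
open import Data.Empty using (⊥; ⊥-elim)
open import Data.Fin using (Fin)
open import Data.Fin.Patterns using (0F; 1F; 2F)
open import Data.List using ([]; _∷_; drop)
open import Data.Nat using (ℕ; zero; suc)
open import Data.Product using (_×_; _,_; proj₁; proj₂; ∃-syntax)
open import Data.Sum using (_⊎_; inj₁; inj₂)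
open import Data.Unit using (⊤; tt)
open import Relation.Nullary using (yes; no)
open import Relation.Unary using (Pred; _⊆_)
open import Relation.Binary.Bundles using (Setoid)
open import Algebra.Bundles using (Semiring)
open import Algebra.Morphism.Structures using (IsSemiringHomomorphism)
import Algebra.Properties.CommutativeSemigroup as CommutativeSemigroupProperties
import Algebra.Properties.Group as GroupProperties
import Relation.Binary.Reasoning.Setoid as SetoidReasoning
open import Defs

-- 3 × 3 matrices over a semiring

module Matrix3 {a ℓ} (S : Semiring a ℓ) where
  open Semiring S hiding (zero)
  open CommutativeSemigroupProperties +-commutativeSemigroup using (interchange)

  Matrix : Set a
  Matrix = Fin 3 → Fin 3 → Carrier

  -- A record rather than a Π-type, so that A and B can be recovered from the type of a proof by unification.
  infix 4 _≈ᴹ_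
  record _≈ᴹ_ (A B : Matrix) : Set ℓ where
    constructor pointwise
    field at : ∀ i j → A i j ≈ B i j
  open _≈ᴹ_ public

  ≈ᴹ-refl : ∀ {A} → A ≈ᴹ A
  ≈ᴹ-refl = pointwise λ i j → refl

  ≈ᴹ-sym : ∀ {A B} → A ≈ᴹ B → B ≈ᴹ A
  ≈ᴹ-sym A≈B = pointwise λ i j → sym (at A≈B i j)

  ≈ᴹ-trans : ∀ {A B C} → A ≈ᴹ B → B ≈ᴹ C → A ≈ᴹ C
  ≈ᴹ-trans A≈B B≈C = pointwise λ i j → trans (at A≈B i j) (at B≈C i j)

  ≈ᴹ-setoid : Setoid a ℓ
  ≈ᴹ-setoid = record
    { Carrier = Matrix ; _≈_ = _≈ᴹ_
    ; isEquivalence = record { refl = ≈ᴹ-refl ; sym = ≈ᴹ-sym ; trans = ≈ᴹ-trans } }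

  entrywise : ∀ {A B : Matrix} →
    A 0F 0F ≈ B 0F 0F → A 0F 1F ≈ B 0F 1F → A 0F 2F ≈ B 0F 2F →
    A 1F 0F ≈ B 1F 0F → A 1F 1F ≈ B 1F 1F → A 1F 2F ≈ B 1F 2F →
    A 2F 0F ≈ B 2F 0F → A 2F 1F ≈ B 2F 1F → A 2F 2F ≈ B 2F 2F → A ≈ᴹ B
  entrywise e₀₀ e₀₁ e₀₂ e₁₀ e₁₁ e₁₂ e₂₀ e₂₁ e₂₂ = pointwise λ where
    0F 0F → e₀₀ ; 0F 1F → e₀₁ ; 0F 2F → e₀₂
    1F 0F → e₁₀ ; 1F 1F → e₁₁ ; 1F 2F → e₁₂
    2F 0F → e₂₀ ; 2F 1F → e₂₁ ; 2F 2F → e₂₂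

  Σ₃ : (Fin 3 → Carrier) → Carrier
  Σ₃ f = f 0F + f 1F + f 2F

  Σ₃-cong : ∀ {f g} → (∀ k → f k ≈ g k) → Σ₃ f ≈ Σ₃ g
  Σ₃-cong f≈g = +-cong (+-cong (f≈g 0F) (f≈g 1F)) (f≈g 2F)

  Σ₃-+ : ∀ f g → Σ₃ (λ k → f k + g k) ≈ Σ₃ f + Σ₃ g
  Σ₃-+ f g = trans (+-cong (interchange (f 0F) (g 0F) (f 1F) (g 1F)) refl)
                   (interchange (f 0F + f 1F) (g 0F + g 1F) (f 2F) (g 2F))

  Σ₃-swap : ∀ (x : Fin 3 → Fin 3 → Carrier) → Σ₃ (λ j → Σ₃ (x j)) ≈ Σ₃ (λ k → Σ₃ (λ j → x j k))
  Σ₃-swap x = trans (Σ₃-+ (λ j → x j 0F + x j 1F) (λ j → x j 2F))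
                    (+-cong (Σ₃-+ (λ j → x j 0F) (λ j → x j 1F)) refl)

  *-distribˡ-Σ₃ : ∀ w f → w * Σ₃ f ≈ Σ₃ (λ k → w * f k)
  *-distribˡ-Σ₃ w f = trans (distribˡ w _ _) (+-cong (distribˡ w _ _) refl)

  *-distribʳ-Σ₃ : ∀ w f → Σ₃ f * w ≈ Σ₃ (λ k → f k * w)
  *-distribʳ-Σ₃ w f = trans (distribʳ w _ _) (+-cong (distribʳ w _ _) refl)

  Σ₃-only₀ : ∀ f → f 1F ≈ 0# → f 2F ≈ 0# → Σ₃ f ≈ f 0F
  Σ₃-only₀ f f₁≈0 f₂≈0 = trans (+-cong (trans (+-congˡ f₁≈0) (+-identityʳ _)) f₂≈0) (+-identityʳ _)

  Σ₃-only₁ : ∀ f → f 0F ≈ 0# → f 2F ≈ 0# → Σ₃ f ≈ f 1F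
  Σ₃-only₁ f f₀≈0 f₂≈0 = trans (+-cong (trans (+-congʳ f₀≈0) (+-identityˡ _)) f₂≈0) (+-identityʳ _)

  Σ₃-only₂ : ∀ f → f 0F ≈ 0# → f 1F ≈ 0# → Σ₃ f ≈ f 2F
  Σ₃-only₂ f f₀≈0 f₁≈0 = trans (+-congʳ (trans (+-cong f₀≈0 f₁≈0) (+-identityʳ 0#))) (+-identityˡ _)

  infixl 7 _⊗_
  _⊗_ : Matrix → Matrix → Matrix
  (A ⊗ B) i j = Σ₃ (λ k → A i k * B k j)

  𝟙 𝟘 : Matrix
  𝟙 0F 0F = 1#
  𝟙 1F 1F = 1#
  𝟙 2F 2F = 1#
  𝟙 _  _  = 0#
  𝟘 _  _  = 0#

  ⊗-cong : ∀ {A A′ B B′} → A ≈ᴹ A′ → B ≈ᴹ B′ → A ⊗ B ≈ᴹ A′ ⊗ B′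
  ⊗-cong A≈A′ B≈B′ = pointwise λ i j → Σ₃-cong (λ k → *-cong (at A≈A′ i k) (at B≈B′ k j))

  ⊗-congˡ : ∀ A {B B′} → B ≈ᴹ B′ → A ⊗ B ≈ᴹ A ⊗ B′
  ⊗-congˡ A B≈B′ = ⊗-cong (≈ᴹ-refl {A}) B≈B′

  ⊗-congʳ : ∀ {A A′} B → A ≈ᴹ A′ → A ⊗ B ≈ᴹ A′ ⊗ B
  ⊗-congʳ B A≈A′ = ⊗-cong A≈A′ (≈ᴹ-refl {B})

  ⊗-assoc : ∀ A B C → (A ⊗ B) ⊗ C ≈ᴹ A ⊗ (B ⊗ C)
  ⊗-assoc A B C = pointwise λ i l → begin
    Σ₃ (λ k → Σ₃ (λ j → A i j * B j k) * C k l)   ≈⟨ Σ₃-cong (λ k → *-distribʳ-Σ₃ (C k l) (λ j → A i j * B j k)) ⟩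
    Σ₃ (λ k → Σ₃ (λ j → A i j * B j k * C k l))   ≈⟨ Σ₃-swap (λ k j → A i j * B j k * C k l) ⟩
    Σ₃ (λ j → Σ₃ (λ k → A i j * B j k * C k l))   ≈⟨ Σ₃-cong (λ j → Σ₃-cong (λ k → *-assoc (A i j) (B j k) (C k l))) ⟩
    Σ₃ (λ j → Σ₃ (λ k → A i j * (B j k * C k l))) ≈⟨ Σ₃-cong (λ j → *-distribˡ-Σ₃ (A i j) (λ k → B j k * C k l)) ⟨
    Σ₃ (λ j → A i j * Σ₃ (λ k → B j k * C k l))   ∎
    where open SetoidReasoning setoid

  ⊗-only₀ : ∀ A B {i j} → A i 1F * B 1F j ≈ 0# → A i 2F * B 2F j ≈ 0# → (A ⊗ B) i j ≈ A i 0F * B 0F j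
  ⊗-only₀ A B {i} {j} = Σ₃-only₀ (λ k → A i k * B k j)

  ⊗-only₁ : ∀ A B {i j} → A i 0F * B 0F j ≈ 0# → A i 2F * B 2F j ≈ 0# → (A ⊗ B) i j ≈ A i 1F * B 1F j
  ⊗-only₁ A B {i} {j} = Σ₃-only₁ (λ k → A i k * B k j)

  ⊗-only₂ : ∀ A B {i j} → A i 0F * B 0F j ≈ 0# → A i 1F * B 1F j ≈ 0# → (A ⊗ B) i j ≈ A i 2F * B 2F j
  ⊗-only₂ A B {i} {j} = Σ₃-only₂ (λ k → A i k * B k j)

  ⊗-identityˡ : ∀ A → 𝟙 ⊗ A ≈ᴹ A
  ⊗-identityˡ A = pointwise λ where
    0F j → trans (Σ₃-only₀ (λ k → 𝟙 0F k * A k j) (zeroˡ _) (zeroˡ _)) (*-identityˡ _)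
    1F j → trans (Σ₃-only₁ (λ k → 𝟙 1F k * A k j) (zeroˡ _) (zeroˡ _)) (*-identityˡ _)
    2F j → trans (Σ₃-only₂ (λ k → 𝟙 2F k * A k j) (zeroˡ _) (zeroˡ _)) (*-identityˡ _)

  ⊗-identityʳ : ∀ A → A ⊗ 𝟙 ≈ᴹ A
  ⊗-identityʳ A = pointwise λ where
    i 0F → trans (Σ₃-only₀ (λ k → A i k * 𝟙 k 0F) (zeroʳ _) (zeroʳ _)) (*-identityʳ _)
    i 1F → trans (Σ₃-only₁ (λ k → A i k * 𝟙 k 1F) (zeroʳ _) (zeroʳ _)) (*-identityʳ _)
    i 2F → trans (Σ₃-only₂ (λ k → A i k * 𝟙 k 2F) (zeroʳ _) (zeroʳ _)) (*-identityʳ _)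

  ⊗-zeroʳ : ∀ A → A ⊗ 𝟘 ≈ᴹ 𝟘
  ⊗-zeroʳ A = pointwise λ i j → trans (Σ₃-only₀ (λ k → A i k * 0#) (zeroʳ _) (zeroʳ _)) (zeroʳ _)

  ⊗-columnʳ : ∀ A B B′ {j j′ w} → (∀ k → B k j ≈ B′ k j′ * w) → ∀ i → (A ⊗ B) i j ≈ (A ⊗ B′) i j′ * w
  ⊗-columnʳ A B B′ {j} {j′} {w} B≈B′w i = begin
    Σ₃ (λ k → A i k * B k j)        ≈⟨ Σ₃-cong (λ k → trans (*-congˡ (B≈B′w k)) (sym (*-assoc (A i k) (B′ k j′) w))) ⟩
    Σ₃ (λ k → A i k * B′ k j′ * w)  ≈⟨ *-distribʳ-Σ₃ w (λ k → A i k * B′ k j′) ⟨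
    Σ₃ (λ k → A i k * B′ k j′) * w  ∎
    where open SetoidReasoning setoid

  ⊗-rowˡ : ∀ A A′ B {i i′ w} → (∀ k → A i k ≈ w * A′ i′ k) → ∀ j → (A ⊗ B) i j ≈ w * (A′ ⊗ B) i′ j
  ⊗-rowˡ A A′ B {i} {i′} {w} A≈wA′ j = begin
    Σ₃ (λ k → A i k * B k j)          ≈⟨ Σ₃-cong (λ k → trans (*-congʳ (A≈wA′ k)) (*-assoc w (A′ i′ k) (B k j))) ⟩
    Σ₃ (λ k → w * (A′ i′ k * B k j))  ≈⟨ *-distribˡ-Σ₃ w (λ k → A′ i′ k * B k j) ⟨
    w * Σ₃ (λ k → A′ i′ k * B k j)    ∎
    where open SetoidReasoning setoid

  ⊗-cancel-middle : ∀ A B C D → B ⊗ C ≈ᴹ 𝟙 → A ⊗ B ⊗ (C ⊗ D) ≈ᴹ A ⊗ D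
  ⊗-cancel-middle A B C D BC≈𝟙 = begin
    A ⊗ B ⊗ (C ⊗ D)    ≈⟨ ⊗-assoc A B (C ⊗ D) ⟩
    A ⊗ (B ⊗ (C ⊗ D))  ≈⟨ ⊗-congˡ A (⊗-assoc B C D) ⟨
    A ⊗ (B ⊗ C ⊗ D)    ≈⟨ ⊗-congˡ A (⊗-congʳ D BC≈𝟙) ⟩
    A ⊗ (𝟙 ⊗ D)        ≈⟨ ⊗-congˡ A (⊗-identityˡ D) ⟩
    A ⊗ D              ∎
    where open SetoidReasoning ≈ᴹ-setoid

  record IsInverse (A B : Matrix) : Set ℓ where
    field
      inverseʳ : A ⊗ B ≈ᴹ 𝟙
      inverseˡ : B ⊗ A ≈ᴹ 𝟙
  open IsInverse public

  IsInverse-sym : ∀ {A B} → IsInverse A B → IsInverse B A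
  IsInverse-sym A⁻¹ = record { inverseʳ = inverseˡ A⁻¹ ; inverseˡ = inverseʳ A⁻¹ }

  IsInverse-⊗ : ∀ {A A⁻¹ B B⁻¹} → IsInverse A A⁻¹ → IsInverse B B⁻¹ → IsInverse (A ⊗ B) (B⁻¹ ⊗ A⁻¹)
  IsInverse-⊗ {A} {A⁻¹} {B} {B⁻¹} A-inv B-inv = record
    { inverseʳ = ≈ᴹ-trans (⊗-cancel-middle A B B⁻¹ A⁻¹ (inverseʳ B-inv)) (inverseʳ A-inv)
    ; inverseˡ = ≈ᴹ-trans (⊗-cancel-middle B⁻¹ A⁻¹ A B (inverseˡ A-inv)) (inverseˡ B-inv) }

module _ {a₁ ℓ₁ a₂ ℓ₂} (S : Semiring a₁ ℓ₁) (T : Semiring a₂ ℓ₂) where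
  private
    module S = Semiring S
    module T = Semiring T

  isSemiringHomomorphism : {f : S.Carrier → T.Carrier} →
    (∀ {x y} → x S.≈ y → f x T.≈ f y) →
    (∀ x y → f (x S.+ y) T.≈ f x T.+ f y) → (∀ x y → f (x S.* y) T.≈ f x T.* f y) →
    f S.0# T.≈ T.0# → f S.1# T.≈ T.1# →
    IsSemiringHomomorphism S.rawSemiring T.rawSemiring f
  isSemiringHomomorphism f-cong +-homo *-homo 0-homo 1-homo = record
    { isNearSemiringHomomorphism = record
      { +-isMonoidHomomorphism = record
        { isMagmaHomomorphism = record { isRelHomomorphism = record { cong = f-cong } ; homo = +-homo }
        ; ε-homo = 0-homo }
      ; *-homo = *-homo }
    ; 1#-homo = 1-homo }

  module Matrix3Homomorphism {f : S.Carrier → T.Carrier}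
    (f-isHomomorphism : IsSemiringHomomorphism S.rawSemiring T.rawSemiring f) where
    private
      module MS = Matrix3 S
      module MT = Matrix3 T
    open IsSemiringHomomorphism f-isHomomorphism

    map : MS.Matrix → MT.Matrix
    map A i j = f (A i j)

    map-cong : ∀ {A B} → A MS.≈ᴹ B → map A MT.≈ᴹ map B
    map-cong A≈B = MT.pointwise λ i j → ⟦⟧-cong (MS.at A≈B i j)

    map-⊗ : ∀ A B → map (A MS.⊗ B) MT.≈ᴹ map A MT.⊗ map B
    map-⊗ A B = MT.pointwise λ i j →
      T.trans (+-homo _ _) (T.+-cong (T.trans (+-homo _ _) (T.+-cong (*-homo _ _) (*-homo _ _))) (*-homo _ _))

    map-𝟙 : map MS.𝟙 MT.≈ᴹ MT.𝟙
    map-𝟙 = MT.entrywise 1#-homo 0#-homo 0#-homo 0#-homo 1#-homo 0#-homo 0#-homo 0#-homo 1#-homo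

    map-IsInverse : ∀ {A B} → MS.IsInverse A B → MT.IsInverse (map A) (map B)
    map-IsInverse {A} {B} A-inv = record
      { inverseʳ = image A B (MS.inverseʳ A-inv) ; inverseˡ = image B A (MS.inverseˡ A-inv) }
      where
      image : ∀ A B → A MS.⊗ B MS.≈ᴹ MS.𝟙 → map A MT.⊗ map B MT.≈ᴹ MT.𝟙
      image A B AB≈𝟙 = MT.≈ᴹ-trans (MT.≈ᴹ-sym (map-⊗ A B)) (MT.≈ᴹ-trans (map-cong AB≈𝟙) map-𝟙)

module Representatives {c ℓ} (F : FiniteField c ℓ) where
  private module R = FiniteField F
  open R using (Carrier; _≈_; _+_; _*_; -_; 0#; 1#)
  open GL3 F
  open GroupProperties R.+-group using (x∙y⁻¹≈ε⇒x≈y)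

  x≈0⇒x*y≈0 : ∀ {x} y → x ≈ 0# → x * y ≈ 0#
  x≈0⇒x*y≈0 y x≈0 = R.trans (R.*-congʳ x≈0) (R.zeroˡ y)

  y≈0⇒x*y≈0 : ∀ x {y} → y ≈ 0# → x * y ≈ 0#
  y≈0⇒x*y≈0 x y≈0 = R.trans (R.*-congˡ y≈0) (R.zeroʳ x)

  1≈0-elim : ∀ {a} {A : Set a} → 1# ≈ 0# → A
  1≈0-elim 1≈0 = ⊥-elim (R.1≉0 1≈0)

  -x+y≈0⇒x≈y : ∀ {x y} → - x + y ≈ 0# → x ≈ y
  -x+y≈0⇒x≈y {x} {y} -x+y≈0 = R.sym (x∙y⁻¹≈ε⇒x≈y y x (R.trans (R.+-comm y (- x)) -x+y≈0))

  unit-cancel : ∀ {x u v} → u * v ≈ 1# → x * u ≈ 0# → x ≈ 0#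
  unit-cancel {x} {u} {v} uv≈1 xu≈0 = begin
    x            ≈⟨ R.*-identityʳ x ⟨
    x * 1#       ≈⟨ R.*-congˡ uv≈1 ⟨
    x * (u * v)  ≈⟨ R.*-assoc x u v ⟨
    x * u * v    ≈⟨ x≈0⇒x*y≈0 v xu≈0 ⟩
    0#           ∎
    where open SetoidReasoning R.setoid

  rescale : ∀ {u w} → u * w ≈ 1# → ∀ x → x ≈ u * (w * x)
  rescale {u} {w} uw≈1 x = begin
    x            ≈⟨ R.*-identityˡ x ⟨
    1# * x       ≈⟨ R.*-congʳ uw≈1 ⟨
    u * w * x    ≈⟨ R.*-assoc u w x ⟩
    u * (w * x)  ∎
    where open SetoidReasoning R.setoid

  unit-or-zero : ∀ x → (∃[ w ] x * w ≈ 1#) ⊎ x ≈ 0#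
  unit-or-zero x with x R.≟ 0#
  ... | yes x≈0 = inj₂ x≈0
  ... | no  x≉0 = inj₁ (R.inverse x x≉0)

  -- Polynomials

  coeff : Poly → ℕ → Carrier
  coeff []       _       = 0#
  coeff (x ∷ _)  zero    = x
  coeff (_ ∷ xs) (suc n) = coeff xs n

  -- Equivalent to _≈ₚ_ (see ≈ₚ⇒≋ and ≋⇒≈ₚ), but it turns every law below into a pointwise identity.
  infix 4 _≋_
  record _≋_ (p q : Poly) : Set ℓ where
    constructor coeffwise
    field coeff-≈ : ∀ n → coeff p n ≈ coeff q n
  open _≋_

  ≋-refl : ∀ {p} → p ≋ p
  ≋-refl = coeffwise λ _ → R.refl

  ≋-sym : ∀ {p q} → p ≋ q → q ≋ p
  ≋-sym p≋q = coeffwise λ n → R.sym (coeff-≈ p≋q n)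

  ≋-trans : ∀ {p q r} → p ≋ q → q ≋ r → p ≋ r
  ≋-trans p≋q q≋r = coeffwise λ n → R.trans (coeff-≈ p≋q n) (coeff-≈ q≋r n)

  ≋-setoid : Setoid c ℓ
  ≋-setoid = record
    { Carrier = Poly ; _≈_ = _≋_
    ; isEquivalence = record { refl = ≋-refl ; sym = ≋-sym ; trans = ≋-trans } }

  ∷-cong : ∀ {x y p q} → x ≈ y → p ≋ q → x ∷ p ≋ y ∷ q
  ∷-cong x≈y p≋q = coeffwise λ where
    zero    → x≈y
    (suc n) → coeff-≈ p≋q n

  ∷-injective : ∀ {x y p q} → x ∷ p ≋ y ∷ q → x ≈ y × p ≋ q
  ∷-injective x∷p≋y∷q = coeff-≈ x∷p≋y∷q zero , coeffwise λ n → coeff-≈ x∷p≋y∷q (suc n)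

  []≋0∷[] : [] ≋ 0# ∷ []
  []≋0∷[] = coeffwise λ where
    zero    → R.refl
    (suc n) → R.refl

  ≈ₚ⇒≋ : ∀ {p q} → p ≈ₚ q → p ≋ q
  ≈ₚ⇒≋ {[]}     {[]}     _              = ≋-refl
  ≈ₚ⇒≋ {[]}     {y ∷ ys} (y≈0 , []≈ys)  = ≋-trans []≋0∷[] (∷-cong (R.sym y≈0) (≈ₚ⇒≋ []≈ys))
  ≈ₚ⇒≋ {x ∷ xs} {[]}     (x≈0 , xs≈[]) = ≋-trans (∷-cong x≈0 (≈ₚ⇒≋ xs≈[])) (≋-sym []≋0∷[])
  ≈ₚ⇒≋ {x ∷ xs} {y ∷ ys} (x≈y , xs≈ys) = ∷-cong x≈y (≈ₚ⇒≋ xs≈ys)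

  ≋⇒≈ₚ : ∀ {p q} → p ≋ q → p ≈ₚ q
  ≋⇒≈ₚ {[]}     {[]}     _   = lift tt
  ≋⇒≈ₚ {[]}     {y ∷ ys} p≋q = R.sym (coeff-≈ p≋q zero) , ≋⇒≈ₚ (coeffwise λ n → coeff-≈ p≋q (suc n))
  ≋⇒≈ₚ {x ∷ xs} {[]}     p≋q = coeff-≈ p≋q zero , ≋⇒≈ₚ (coeffwise λ n → coeff-≈ p≋q (suc n))
  ≋⇒≈ₚ {x ∷ xs} {y ∷ ys} p≋q = coeff-≈ p≋q zero , ≋⇒≈ₚ (coeffwise λ n → coeff-≈ p≋q (suc n))

  coeff-+ₚ : ∀ p q n → coeff (p +ₚ q) n ≈ coeff p n + coeff q n
  coeff-+ₚ []       q        n       = R.sym (R.+-identityˡ _)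
  coeff-+ₚ (x ∷ xs) []       n       = R.sym (R.+-identityʳ _)
  coeff-+ₚ (x ∷ xs) (y ∷ ys) zero    = R.refl
  coeff-+ₚ (x ∷ xs) (y ∷ ys) (suc n) = coeff-+ₚ xs ys n

  coeff-scale : ∀ a p n → coeff (scale a p) n ≈ a * coeff p n
  coeff-scale a []       n       = R.sym (R.zeroʳ a)
  coeff-scale a (x ∷ xs) zero    = R.refl
  coeff-scale a (x ∷ xs) (suc n) = coeff-scale a xs n

  +ₚ-cong : ∀ {p p′ q q′} → p ≋ p′ → q ≋ q′ → p +ₚ q ≋ p′ +ₚ q′
  +ₚ-cong {p} {p′} {q} {q′} p≋p′ q≋q′ = coeffwise λ n → begin
    coeff (p +ₚ q) n         ≈⟨ coeff-+ₚ p q n ⟩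
    coeff p n + coeff q n    ≈⟨ R.+-cong (coeff-≈ p≋p′ n) (coeff-≈ q≋q′ n) ⟩
    coeff p′ n + coeff q′ n  ≈⟨ coeff-+ₚ p′ q′ n ⟨
    coeff (p′ +ₚ q′) n       ∎
    where open SetoidReasoning R.setoid

  +ₚ-assoc : ∀ p q r → (p +ₚ q) +ₚ r ≋ p +ₚ (q +ₚ r)
  +ₚ-assoc p q r = coeffwise λ n → begin
    coeff ((p +ₚ q) +ₚ r) n              ≈⟨ R.trans (coeff-+ₚ (p +ₚ q) r n) (R.+-congʳ (coeff-+ₚ p q n)) ⟩
    coeff p n + coeff q n + coeff r n    ≈⟨ R.+-assoc _ _ _ ⟩
    coeff p n + (coeff q n + coeff r n)  ≈⟨ R.trans (coeff-+ₚ p (q +ₚ r) n) (R.+-congˡ (coeff-+ₚ q r n)) ⟨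
    coeff (p +ₚ (q +ₚ r)) n              ∎
    where open SetoidReasoning R.setoid

  +ₚ-comm : ∀ p q → p +ₚ q ≋ q +ₚ p
  +ₚ-comm p q = coeffwise λ n → begin
    coeff (p +ₚ q) n       ≈⟨ coeff-+ₚ p q n ⟩
    coeff p n + coeff q n  ≈⟨ R.+-comm _ _ ⟩
    coeff q n + coeff p n  ≈⟨ coeff-+ₚ q p n ⟨
    coeff (q +ₚ p) n       ∎
    where open SetoidReasoning R.setoid

  +ₚ-identityʳ : ∀ p → p +ₚ [] ≋ p
  +ₚ-identityʳ p = coeffwise λ n → R.trans (coeff-+ₚ p [] n) (R.+-identityʳ _)

  +ₚ-interchange : ∀ p q r s → (p +ₚ q) +ₚ (r +ₚ s) ≋ (p +ₚ r) +ₚ (q +ₚ s)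
  +ₚ-interchange p q r s = coeffwise λ n → begin
    coeff ((p +ₚ q) +ₚ (r +ₚ s)) n
      ≈⟨ R.trans (coeff-+ₚ (p +ₚ q) (r +ₚ s) n) (R.+-cong (coeff-+ₚ p q n) (coeff-+ₚ r s n)) ⟩
    (coeff p n + coeff q n) + (coeff r n + coeff s n)
      ≈⟨ interchange _ _ _ _ ⟩
    (coeff p n + coeff r n) + (coeff q n + coeff s n)
      ≈⟨ R.trans (coeff-+ₚ (p +ₚ r) (q +ₚ s) n) (R.+-cong (coeff-+ₚ p r n) (coeff-+ₚ q s n)) ⟨
    coeff ((p +ₚ r) +ₚ (q +ₚ s)) n ∎
    where
    open SetoidReasoning R.setoid
    open CommutativeSemigroupProperties R.+-commutativeSemigroup using (interchange)

  scale-cong : ∀ {a b p q} → a ≈ b → p ≋ q → scale a p ≋ scale b q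
  scale-cong {a} {b} {p} {q} a≈b p≋q = coeffwise λ n → begin
    coeff (scale a p) n  ≈⟨ coeff-scale a p n ⟩
    a * coeff p n        ≈⟨ R.*-cong a≈b (coeff-≈ p≋q n) ⟩
    b * coeff q n        ≈⟨ coeff-scale b q n ⟨
    coeff (scale b q) n  ∎
    where open SetoidReasoning R.setoid

  scale-distribˡ : ∀ a p q → scale a (p +ₚ q) ≋ scale a p +ₚ scale a q
  scale-distribˡ a p q = coeffwise λ n → begin
    coeff (scale a (p +ₚ q)) n        ≈⟨ R.trans (coeff-scale a (p +ₚ q) n) (R.*-congˡ (coeff-+ₚ p q n)) ⟩
    a * (coeff p n + coeff q n)       ≈⟨ R.distribˡ a _ _ ⟩
    a * coeff p n + a * coeff q n     ≈⟨ R.trans (coeff-+ₚ (scale a p) (scale a q) n)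
                                                 (R.+-cong (coeff-scale a p n) (coeff-scale a q n)) ⟨
    coeff (scale a p +ₚ scale a q) n  ∎
    where open SetoidReasoning R.setoid

  scale-distribʳ : ∀ a b p → scale (a + b) p ≋ scale a p +ₚ scale b p
  scale-distribʳ a b p = coeffwise λ n → begin
    coeff (scale (a + b) p) n         ≈⟨ coeff-scale (a + b) p n ⟩
    (a + b) * coeff p n               ≈⟨ R.distribʳ _ a b ⟩
    a * coeff p n + b * coeff p n     ≈⟨ R.trans (coeff-+ₚ (scale a p) (scale b p) n)
                                                 (R.+-cong (coeff-scale a p n) (coeff-scale b p n)) ⟨
    coeff (scale a p +ₚ scale b p) n  ∎
    where open SetoidReasoning R.setoid

  scale-assoc : ∀ a b p → scale a (scale b p) ≋ scale (a * b) p
  scale-assoc a b p = coeffwise λ n → begin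
    coeff (scale a (scale b p)) n  ≈⟨ R.trans (coeff-scale a (scale b p) n) (R.*-congˡ (coeff-scale b p n)) ⟩
    a * (b * coeff p n)            ≈⟨ R.*-assoc a b _ ⟨
    a * b * coeff p n              ≈⟨ coeff-scale (a * b) p n ⟨
    coeff (scale (a * b) p) n      ∎
    where open SetoidReasoning R.setoid

  scale-zero : ∀ p → scale 0# p ≋ []
  scale-zero p = coeffwise λ n → R.trans (coeff-scale 0# p n) (R.zeroˡ _)

  scale-identity : ∀ p → scale 1# p ≋ p
  scale-identity p = coeffwise λ n → R.trans (coeff-scale 1# p n) (R.*-identityˡ _)

  0∷-+ₚ : ∀ p q → (0# ∷ p) +ₚ (0# ∷ q) ≋ 0# ∷ (p +ₚ q)
  0∷-+ₚ p q = ∷-cong (R.+-identityʳ 0#) ≋-refl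

  0∷-*ₚ : ∀ p q → (0# ∷ p) *ₚ q ≋ 0# ∷ (p *ₚ q)
  0∷-*ₚ p q = +ₚ-cong (scale-zero q) ≋-refl

  *ₚ-zeroʳ : ∀ p → p *ₚ [] ≋ []
  *ₚ-zeroʳ []       = ≋-refl
  *ₚ-zeroʳ (x ∷ xs) = ≋-trans (∷-cong R.refl (*ₚ-zeroʳ xs)) (≋-sym []≋0∷[])

  ≋[]⇒*ₚ≋[] : ∀ {p} → p ≋ [] → ∀ q → p *ₚ q ≋ []
  ≋[]⇒*ₚ≋[] {[]}     _   q = ≋-refl
  ≋[]⇒*ₚ≋[] {x ∷ xs} p≋0 q = begin
    scale x q +ₚ (0# ∷ xs *ₚ q)  ≈⟨ +ₚ-cong (scale-cong x≈0 ≋-refl) (∷-cong R.refl (≋[]⇒*ₚ≋[] xs≋0 q)) ⟩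
    scale 0# q +ₚ (0# ∷ [])      ≈⟨ +ₚ-cong (scale-zero q) ≋-refl ⟩
    0# ∷ []                      ≈⟨ []≋0∷[] ⟨
    []                           ∎
    where
    open SetoidReasoning ≋-setoid
    x≈0 : x ≈ 0#
    x≈0 = coeff-≈ p≋0 zero
    xs≋0 : xs ≋ []
    xs≋0 = coeffwise λ n → coeff-≈ p≋0 (suc n)

  *ₚ-congˡ : ∀ {p p′} q → p ≋ p′ → p *ₚ q ≋ p′ *ₚ q
  *ₚ-congˡ {[]}     {[]}     q _    = ≋-refl
  *ₚ-congˡ {[]}     {y ∷ ys} q p≋p′ = ≋-sym (≋[]⇒*ₚ≋[] (≋-sym p≋p′) q)
  *ₚ-congˡ {x ∷ xs} {[]}     q p≋p′ = ≋[]⇒*ₚ≋[] p≋p′ q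
  *ₚ-congˡ {x ∷ xs} {y ∷ ys} q p≋p′ with ∷-injective p≋p′
  ... | x≈y , xs≋ys = +ₚ-cong (scale-cong x≈y ≋-refl) (∷-cong R.refl (*ₚ-congˡ q xs≋ys))

  *ₚ-congʳ : ∀ p {q q′} → q ≋ q′ → p *ₚ q ≋ p *ₚ q′
  *ₚ-congʳ []       q≋q′ = ≋-refl
  *ₚ-congʳ (x ∷ xs) q≋q′ = +ₚ-cong (scale-cong R.refl q≋q′) (∷-cong R.refl (*ₚ-congʳ xs q≋q′))

  *ₚ-distribʳ : ∀ r p q → (p +ₚ q) *ₚ r ≋ p *ₚ r +ₚ q *ₚ r
  *ₚ-distribʳ r []       q        = ≋-refl
  *ₚ-distribʳ r (x ∷ xs) []       = ≋-sym (+ₚ-identityʳ _)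
  *ₚ-distribʳ r (x ∷ xs) (y ∷ ys) = begin
    scale (x + y) r +ₚ (0# ∷ (xs +ₚ ys) *ₚ r)
      ≈⟨ +ₚ-cong (scale-distribʳ x y r)
                 (≋-trans (∷-cong R.refl (*ₚ-distribʳ r xs ys)) (≋-sym (0∷-+ₚ (xs *ₚ r) (ys *ₚ r)))) ⟩
    (scale x r +ₚ scale y r) +ₚ ((0# ∷ xs *ₚ r) +ₚ (0# ∷ ys *ₚ r))
      ≈⟨ +ₚ-interchange (scale x r) (scale y r) (0# ∷ xs *ₚ r) (0# ∷ ys *ₚ r) ⟩
    (scale x r +ₚ (0# ∷ xs *ₚ r)) +ₚ (scale y r +ₚ (0# ∷ ys *ₚ r)) ∎
    where open SetoidReasoning ≋-setoid

  *ₚ-distribˡ : ∀ p q r → p *ₚ (q +ₚ r) ≋ p *ₚ q +ₚ p *ₚ r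
  *ₚ-distribˡ []       q r = ≋-refl
  *ₚ-distribˡ (x ∷ xs) q r = begin
    scale x (q +ₚ r) +ₚ (0# ∷ xs *ₚ (q +ₚ r))
      ≈⟨ +ₚ-cong (scale-distribˡ x q r)
                 (≋-trans (∷-cong R.refl (*ₚ-distribˡ xs q r)) (≋-sym (0∷-+ₚ (xs *ₚ q) (xs *ₚ r)))) ⟩
    (scale x q +ₚ scale x r) +ₚ ((0# ∷ xs *ₚ q) +ₚ (0# ∷ xs *ₚ r))
      ≈⟨ +ₚ-interchange (scale x q) (scale x r) (0# ∷ xs *ₚ q) (0# ∷ xs *ₚ r) ⟩
    (scale x q +ₚ (0# ∷ xs *ₚ q)) +ₚ (scale x r +ₚ (0# ∷ xs *ₚ r)) ∎
    where open SetoidReasoning ≋-setoid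

  scale-*ₚ : ∀ a p q → scale a p *ₚ q ≋ scale a (p *ₚ q)
  scale-*ₚ a []       q = ≋-refl
  scale-*ₚ a (x ∷ xs) q = begin
    scale (a * x) q +ₚ (0# ∷ scale a xs *ₚ q)
      ≈⟨ +ₚ-cong (≋-sym (scale-assoc a x q)) (∷-cong (R.sym (R.zeroʳ a)) (scale-*ₚ a xs q)) ⟩
    scale a (scale x q) +ₚ scale a (0# ∷ xs *ₚ q)
      ≈⟨ scale-distribˡ a (scale x q) (0# ∷ xs *ₚ q) ⟨
    scale a (scale x q +ₚ (0# ∷ xs *ₚ q)) ∎
    where open SetoidReasoning ≋-setoid

  *ₚ-assoc : ∀ p q r → (p *ₚ q) *ₚ r ≋ p *ₚ (q *ₚ r)
  *ₚ-assoc []       q r = ≋-refl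
  *ₚ-assoc (x ∷ xs) q r = begin
    (scale x q +ₚ (0# ∷ xs *ₚ q)) *ₚ r         ≈⟨ *ₚ-distribʳ r (scale x q) (0# ∷ xs *ₚ q) ⟩
    scale x q *ₚ r +ₚ (0# ∷ xs *ₚ q) *ₚ r      ≈⟨ +ₚ-cong (scale-*ₚ x q r) (0∷-*ₚ (xs *ₚ q) r) ⟩
    scale x (q *ₚ r) +ₚ (0# ∷ (xs *ₚ q) *ₚ r)  ≈⟨ +ₚ-cong ≋-refl (∷-cong R.refl (*ₚ-assoc xs q r)) ⟩
    scale x (q *ₚ r) +ₚ (0# ∷ xs *ₚ (q *ₚ r))  ∎
    where open SetoidReasoning ≋-setoid

  *ₚ-identityˡ : ∀ p → 1ₚ *ₚ p ≋ p
  *ₚ-identityˡ p = ≋-trans (+ₚ-cong (scale-identity p) (≋-sym []≋0∷[])) (+ₚ-identityʳ p)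

  *ₚ-identityʳ : ∀ p → p *ₚ 1ₚ ≋ p
  *ₚ-identityʳ []       = ≋-refl
  *ₚ-identityʳ (x ∷ xs) = ∷-cong (R.trans (R.+-identityʳ _) (R.*-identityʳ x)) (*ₚ-identityʳ xs)

  Poly-semiring : Semiring c ℓ
  Poly-semiring = record
    { Carrier = Poly ; _≈_ = _≋_ ; _+_ = _+ₚ_ ; _*_ = _*ₚ_ ; 0# = [] ; 1# = 1ₚ
    ; isSemiring = record
      { isSemiringWithoutAnnihilatingZero = record
        { +-isCommutativeMonoid = record
          { isMonoid = record
            { isSemigroup = record
              { isMagma = record { isEquivalence = Setoid.isEquivalence ≋-setoid ; ∙-cong = +ₚ-cong }
              ; assoc = +ₚ-assoc }
            ; identity = (λ _ → ≋-refl) , +ₚ-identityʳ }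
          ; comm = +ₚ-comm }
        ; *-cong = λ {p} {p′} {q} {q′} p≋p′ q≋q′ → ≋-trans (*ₚ-congˡ q p≋p′) (*ₚ-congʳ p′ q≋q′)
        ; *-assoc = *ₚ-assoc
        ; *-identity = *ₚ-identityˡ , *ₚ-identityʳ
        ; distrib = *ₚ-distribˡ , *ₚ-distribʳ }
      ; zero = (λ _ → ≋-refl) , *ₚ-zeroʳ } }

  *ₚ-0∷ : ∀ p q → p *ₚ (0# ∷ q) ≋ 0# ∷ (p *ₚ q)
  *ₚ-0∷ []       q = []≋0∷[]
  *ₚ-0∷ (x ∷ xs) q = ∷-cong (R.trans (R.+-identityʳ _) (R.zeroʳ x)) (+ₚ-cong ≋-refl (*ₚ-0∷ xs q))

  tₚ-*ₚ : ∀ p → tₚ *ₚ p ≋ 0# ∷ p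
  tₚ-*ₚ p = ≋-trans (0∷-*ₚ 1ₚ p) (∷-cong R.refl (*ₚ-identityˡ p))

  *ₚ-tₚ : ∀ p → p *ₚ tₚ ≋ 0# ∷ p
  *ₚ-tₚ p = ≋-trans (*ₚ-0∷ p 1ₚ) (∷-cong R.refl (*ₚ-identityʳ p))

  red-coeff : ∀ p → red p ≈ coeff p zero
  red-coeff []      = R.refl
  red-coeff (_ ∷ _) = R.refl

  red-cong : ∀ {p q} → p ≋ q → red p ≈ red q
  red-cong {p} {q} p≋q = R.trans (red-coeff p) (R.trans (coeff-≈ p≋q zero) (R.sym (red-coeff q)))

  red-+ₚ : ∀ p q → red (p +ₚ q) ≈ red p + red q
  red-+ₚ p q = R.trans (red-coeff (p +ₚ q))
    (R.trans (coeff-+ₚ p q zero) (R.sym (R.+-cong (red-coeff p) (red-coeff q))))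

  red-*ₚ : ∀ p q → red (p *ₚ q) ≈ red p * red q
  red-*ₚ []       q = R.sym (R.zeroˡ _)
  red-*ₚ (x ∷ xs) q = begin
    red (scale x q +ₚ (0# ∷ xs *ₚ q))  ≈⟨ red-+ₚ (scale x q) (0# ∷ xs *ₚ q) ⟩
    red (scale x q) + 0#               ≈⟨ R.+-identityʳ _ ⟩
    red (scale x q)                    ≈⟨ R.trans (red-coeff (scale x q)) (coeff-scale x q zero) ⟩
    x * coeff q zero                   ≈⟨ R.*-congˡ (red-coeff q) ⟨
    x * red q                          ∎
    where open SetoidReasoning R.setoid

  red-isHomomorphism :
    IsSemiringHomomorphism (Semiring.rawSemiring Poly-semiring) (Semiring.rawSemiring R.semiring) red
  red-isHomomorphism = isSemiringHomomorphism Poly-semiring R.semiring red-cong red-+ₚ red-*ₚ R.refl R.refl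

  const-isHomomorphism :
    IsSemiringHomomorphism (Semiring.rawSemiring R.semiring) (Semiring.rawSemiring Poly-semiring) const
  const-isHomomorphism = isSemiringHomomorphism R.semiring Poly-semiring
    (λ x≈y → ∷-cong x≈y ≋-refl) (λ _ _ → ≋-refl) (λ _ _ → ∷-cong (R.sym (R.+-identityʳ _)) ≋-refl)
    (≋-sym []≋0∷[]) ≋-refl

  -- Matrices over A and over F_q

  -- The product _·_ of Defs is definitionally 𝔸._⊗_, so the generic lemmas apply to it as they stand.
  module 𝔸 = Matrix3 Poly-semiring
  module 𝔽 = Matrix3 R.semiring
  open 𝔸 using (_≈ᴹ_; pointwise; at; entrywise; ≈ᴹ-refl; ≈ᴹ-sym; ≈ᴹ-trans; ≈ᴹ-setoid;
                IsInverse; inverseʳ; inverseˡ; IsInverse-sym; IsInverse-⊗)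
    renaming (⊗-cong to ·-cong; ⊗-congˡ to ·-congˡ; ⊗-congʳ to ·-congʳ; ⊗-assoc to ·-assoc;
              ⊗-identityˡ to ·-identityˡ; ⊗-identityʳ to ·-identityʳ)
  open 𝔽 using ()
    renaming (Matrix to FMatrix; _≈ᴹ_ to _≈ᶠ_; pointwise to pointwiseᶠ; at to atᶠ; _⊗_ to _⊙_; 𝟙 to 𝟏; 𝟘 to 𝟎;
              IsInverse to IsInverseᶠ; inverseʳ to inverseʳᶠ; inverseˡ to inverseˡᶠ)
  open Matrix3Homomorphism Poly-semiring R.semiring red-isHomomorphism using ()
    renaming (map to redM; map-cong to redM-cong; map-⊗ to redM-·; map-IsInverse to redM-IsInverse)
  open Matrix3Homomorphism R.semiring Poly-semiring const-isHomomorphism using ()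
    renaming (map to constM; map-cong to constM-cong; map-IsInverse to constM-IsInverse)

  ≈ₘ⇒≈ᴹ : ∀ {M N} → M ≈ₘ N → M ≈ᴹ N
  ≈ₘ⇒≈ᴹ M≈N = pointwise λ i j → ≈ₚ⇒≋ (M≈N i j)

  ≈ᴹ⇒≈ₘ : ∀ {M N} → M ≈ᴹ N → M ≈ₘ N
  ≈ᴹ⇒≈ₘ M≈N i j = ≋⇒≈ₚ (at M≈N i j)

  mat-η : ∀ M → mat (M 0F 0F) (M 0F 1F) (M 0F 2F) (M 1F 0F) (M 1F 1F) (M 1F 2F) (M 2F 0F) (M 2F 1F) (M 2F 2F) ≈ᴹ M
  mat-η M = entrywise ≋-refl ≋-refl ≋-refl ≋-refl ≋-refl ≋-refl ≋-refl ≋-refl ≋-refl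

  ≈mat⇒≈ᴹ : ∀ M {s} →
    s ≈ₘ mat (M 0F 0F) (M 0F 1F) (M 0F 2F) (M 1F 0F) (M 1F 1F) (M 1F 2F) (M 2F 0F) (M 2F 1F) (M 2F 2F) → s ≈ᴹ M
  ≈mat⇒≈ᴹ M s≈ = ≈ᴹ-trans (≈ₘ⇒≈ᴹ s≈) (mat-η M)

  ≈ᴹ⇒≈mat : ∀ M {s} →
    s ≈ᴹ M → s ≈ₘ mat (M 0F 0F) (M 0F 1F) (M 0F 2F) (M 1F 0F) (M 1F 1F) (M 1F 2F) (M 2F 0F) (M 2F 1F) (M 2F 2F)
  ≈ᴹ⇒≈mat M s≈M = ≈ᴹ⇒≈ₘ (≈ᴹ-trans s≈M (≈ᴹ-sym (mat-η M)))

  I₃≈𝟙 : I₃ ≈ᴹ 𝔸.𝟙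
  I₃≈𝟙 = entrywise ≋-refl ≋-refl ≋-refl ≋-refl ≋-refl ≋-refl ≋-refl ≋-refl ≋-refl

  IsInverse-I₃ : IsInverse I₃ I₃
  IsInverse-I₃ = record { inverseʳ = I₃·I₃≈𝟙 ; inverseˡ = I₃·I₃≈𝟙 }
    where
    I₃·I₃≈𝟙 : I₃ · I₃ ≈ᴹ 𝔸.𝟙
    I₃·I₃≈𝟙 = ≈ᴹ-trans (·-cong I₃≈𝟙 I₃≈𝟙) (·-identityˡ 𝔸.𝟙)

  GL3A⇒IsInverse : ∀ M (M∈GL : GL3A M) → IsInverse M (proj₁ M∈GL)
  GL3A⇒IsInverse M (_ , MN≈I , NM≈I) = record
    { inverseʳ = ≈ᴹ-trans (≈ₘ⇒≈ᴹ MN≈I) I₃≈𝟙 ; inverseˡ = ≈ᴹ-trans (≈ₘ⇒≈ᴹ NM≈I) I₃≈𝟙 }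

  IsInverse⇒GL3A : ∀ {M N} → IsInverse M N → GL3A M
  IsInverse⇒GL3A {N = N} M-inv =
    N , ≈ᴹ⇒≈ₘ (≈ᴹ-trans (inverseʳ M-inv) (≈ᴹ-sym I₃≈𝟙)) , ≈ᴹ⇒≈ₘ (≈ᴹ-trans (inverseˡ M-inv) (≈ᴹ-sym I₃≈𝟙))

  GL3A-· : ∀ M N → GL3A M → GL3A N → GL3A (M · N)
  GL3A-· M N M∈GL N∈GL = IsInverse⇒GL3A (IsInverse-⊗ (GL3A⇒IsInverse M M∈GL) (GL3A⇒IsInverse N N∈GL))

  constM-GL3A : ∀ {G H} → IsInverseᶠ G H → GL3A (constM G)
  constM-GL3A G-inv = IsInverse⇒GL3A (constM-IsInverse G-inv)

  redM-I₃ : redM I₃ ≈ᶠ 𝟏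
  redM-I₃ = 𝔽.entrywise R.refl R.refl R.refl R.refl R.refl R.refl R.refl R.refl R.refl

  lastColumn-inverse : ∀ A B → B ⊙ A ≈ᶠ 𝟏 → A 0F 2F ≈ 0# → A 1F 2F ≈ 0# → B 0F 2F ≈ 0# × B 1F 2F ≈ 0#
  lastColumn-inverse A B BA≈𝟏 A₀₂≈0 A₁₂≈0 =
    unit-cancel A₂₂B₂₂≈1 (R.trans (R.sym (BA-column 0F)) (atᶠ BA≈𝟏 0F 2F)) ,
    unit-cancel A₂₂B₂₂≈1 (R.trans (R.sym (BA-column 1F)) (atᶠ BA≈𝟏 1F 2F))
    where
    BA-column : ∀ i → (B ⊙ A) i 2F ≈ B i 2F * A 2F 2F
    BA-column i = 𝔽.⊗-only₂ B A (y≈0⇒x*y≈0 (B i 0F) A₀₂≈0) (y≈0⇒x*y≈0 (B i 1F) A₁₂≈0)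
    A₂₂B₂₂≈1 : A 2F 2F * B 2F 2F ≈ 1#
    A₂₂B₂₂≈1 = R.trans (R.*-comm _ _) (R.trans (R.sym (BA-column 2F)) (atᶠ BA≈𝟏 2F 2F))

  firstRow-inverse : ∀ A B → A ⊙ B ≈ᶠ 𝟏 → A 0F 1F ≈ 0# → A 0F 2F ≈ 0# → B 0F 1F ≈ 0# × B 0F 2F ≈ 0#
  firstRow-inverse A B AB≈𝟏 A₀₁≈0 A₀₂≈0 =
    unit-cancel A₀₀B₀₀≈1 (R.trans (R.*-comm _ _) (R.trans (R.sym (AB-row 1F)) (atᶠ AB≈𝟏 0F 1F))) ,
    unit-cancel A₀₀B₀₀≈1 (R.trans (R.*-comm _ _) (R.trans (R.sym (AB-row 2F)) (atᶠ AB≈𝟏 0F 2F)))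
    where
    AB-row : ∀ j → (A ⊙ B) 0F j ≈ A 0F 0F * B 0F j
    AB-row j = 𝔽.⊗-only₀ A B (x≈0⇒x*y≈0 (B 1F j) A₀₁≈0) (x≈0⇒x*y≈0 (B 2F j) A₀₂≈0)
    A₀₀B₀₀≈1 : A 0F 0F * B 0F 0F ≈ 1#
    A₀₀B₀₀≈1 = R.trans (R.sym (AB-row 0F)) (atᶠ AB≈𝟏 0F 0F)

  first-columns-independent : ∀ A B → B ⊙ A ≈ᶠ 𝟏 →
    A 0F 0F ≈ 0# → A 2F 0F ≈ 0# → A 0F 1F ≈ 0# → A 2F 1F ≈ 0# → ⊥
  first-columns-independent A B BA≈𝟏 A₀₀≈0 A₂₀≈0 A₀₁≈0 A₂₁≈0 =
    R.1≉0 (R.trans (R.sym B₀₁A₁₀≈1) (x≈0⇒x*y≈0 (A 1F 0F) B₀₁≈0))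
    where
    BA-entry : ∀ i j → A 0F j ≈ 0# → A 2F j ≈ 0# → B i 1F * A 1F j ≈ (B ⊙ A) i j
    BA-entry i j A₀ⱼ≈0 A₂ⱼ≈0 = R.sym (𝔽.⊗-only₁ B A (y≈0⇒x*y≈0 (B i 0F) A₀ⱼ≈0) (y≈0⇒x*y≈0 (B i 2F) A₂ⱼ≈0))
    B₀₁A₁₀≈1 : B 0F 1F * A 1F 0F ≈ 1#
    B₀₁A₁₀≈1 = R.trans (BA-entry 0F 0F A₀₀≈0 A₂₀≈0) (atᶠ BA≈𝟏 0F 0F)
    A₁₁B₁₁≈1 : A 1F 1F * B 1F 1F ≈ 1#
    A₁₁B₁₁≈1 = R.trans (R.*-comm _ _) (R.trans (BA-entry 1F 1F A₀₁≈0 A₂₁≈0) (atᶠ BA≈𝟏 1F 1F))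
    B₀₁≈0 : B 0F 1F ≈ 0#
    B₀₁≈0 = unit-cancel A₁₁B₁₁≈1 (R.trans (BA-entry 0F 1F A₀₁≈0 A₂₁≈0) (atᶠ BA≈𝟏 0F 1F))

  -- Entries known to be 0 or 1 stay symbolic, so that products of the constant matrices below simplify by
  -- computation.
  data Entry : Set c where
    0ₑ 1ₑ : Entry
    ⟨_⟩   : Carrier → Entry

  ⟦_⟧ : Entry → Carrier
  ⟦ 0ₑ ⟧    = 0#
  ⟦ 1ₑ ⟧    = 1#
  ⟦ ⟨ x ⟩ ⟧ = x

  infixl 7 _*ₑ_
  _*ₑ_ : Entry → Entry → Entry
  0ₑ    *ₑ _     = 0ₑ
  1ₑ    *ₑ y     = y
  ⟨ x ⟩ *ₑ 0ₑ    = 0ₑ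
  ⟨ x ⟩ *ₑ 1ₑ    = ⟨ x ⟩
  ⟨ x ⟩ *ₑ ⟨ y ⟩ = ⟨ x * y ⟩

  infixl 6 _+ₑ_
  _+ₑ_ : Entry → Entry → Entry
  0ₑ +ₑ y  = y
  x  +ₑ 0ₑ = x
  x  +ₑ y  = ⟨ ⟦ x ⟧ + ⟦ y ⟧ ⟩

  ⟦*ₑ⟧ : ∀ x y → ⟦ x *ₑ y ⟧ ≈ ⟦ x ⟧ * ⟦ y ⟧
  ⟦*ₑ⟧ 0ₑ    y     = R.sym (R.zeroˡ _)
  ⟦*ₑ⟧ 1ₑ    y     = R.sym (R.*-identityˡ _)
  ⟦*ₑ⟧ ⟨ x ⟩ 0ₑ    = R.sym (R.zeroʳ _)
  ⟦*ₑ⟧ ⟨ x ⟩ 1ₑ    = R.sym (R.*-identityʳ _)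
  ⟦*ₑ⟧ ⟨ x ⟩ ⟨ y ⟩ = R.refl

  ⟦+ₑ⟧ : ∀ x y → ⟦ x +ₑ y ⟧ ≈ ⟦ x ⟧ + ⟦ y ⟧
  ⟦+ₑ⟧ 0ₑ    y     = R.sym (R.+-identityˡ _)
  ⟦+ₑ⟧ 1ₑ    0ₑ    = R.sym (R.+-identityʳ _)
  ⟦+ₑ⟧ ⟨ x ⟩ 0ₑ    = R.sym (R.+-identityʳ _)
  ⟦+ₑ⟧ 1ₑ    1ₑ    = R.refl
  ⟦+ₑ⟧ 1ₑ    ⟨ y ⟩ = R.refl
  ⟦+ₑ⟧ ⟨ x ⟩ 1ₑ    = R.refl
  ⟦+ₑ⟧ ⟨ x ⟩ ⟨ y ⟩ = R.refl

  SparseMatrix : Set c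
  SparseMatrix = Fin 3 → Fin 3 → Entry

  sparse : Entry → Entry → Entry → Entry → Entry → Entry → Entry → Entry → Entry → SparseMatrix
  sparse a b c d e f g h k = λ where
    0F 0F → a ; 0F 1F → b ; 0F 2F → c
    1F 0F → d ; 1F 1F → e ; 1F 2F → f
    2F 0F → g ; 2F 1F → h ; 2F 2F → k

  ⟦_⟧ₘ : SparseMatrix → FMatrix
  ⟦ A ⟧ₘ i j = ⟦ A i j ⟧

  infixl 7 _⊙ₑ_
  _⊙ₑ_ : SparseMatrix → SparseMatrix → SparseMatrix
  (A ⊙ₑ B) i j = A i 0F *ₑ B 0F j +ₑ A i 1F *ₑ B 1F j +ₑ A i 2F *ₑ B 2F j

  ⟦⊙ₑ⟧ : ∀ A B → ⟦ A ⊙ₑ B ⟧ₘ ≈ᶠ ⟦ A ⟧ₘ ⊙ ⟦ B ⟧ₘ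
  ⟦⊙ₑ⟧ A B = pointwiseᶠ λ i j →
    R.trans (⟦+ₑ⟧ (A i 0F *ₑ B 0F j +ₑ A i 1F *ₑ B 1F j) (A i 2F *ₑ B 2F j))
      (R.+-cong (R.trans (⟦+ₑ⟧ (A i 0F *ₑ B 0F j) (A i 1F *ₑ B 1F j))
                         (R.+-cong (⟦*ₑ⟧ (A i 0F) (B 0F j)) (⟦*ₑ⟧ (A i 1F) (B 1F j))))
                (⟦*ₑ⟧ (A i 2F) (B 2F j)))

  sparse-inverse : ∀ A B → ⟦ A ⊙ₑ B ⟧ₘ ≈ᶠ 𝟏 → ⟦ B ⊙ₑ A ⟧ₘ ≈ᶠ 𝟏 → IsInverseᶠ ⟦ A ⟧ₘ ⟦ B ⟧ₘ
  sparse-inverse A B AB≈𝟏 BA≈𝟏 = record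
    { inverseʳ = 𝔽.≈ᴹ-trans (𝔽.≈ᴹ-sym (⟦⊙ₑ⟧ A B)) AB≈𝟏 ; inverseˡ = 𝔽.≈ᴹ-trans (𝔽.≈ᴹ-sym (⟦⊙ₑ⟧ B A)) BA≈𝟏 }

  q₁ q₂ : Carrier → Carrier → SparseMatrix
  q₁ a b = sparse 1ₑ 0ₑ ⟨ a ⟩  0ₑ 1ₑ ⟨ b ⟩  0ₑ 0ₑ 1ₑ
  q₂ a b = sparse 1ₑ ⟨ a ⟩ ⟨ b ⟩  0ₑ 1ₑ 0ₑ  0ₑ 0ₑ 1ₑ

  r₁ r₁⁻ r₂ r₂⁻ : Carrier → SparseMatrix
  r₁  a = sparse 1ₑ ⟨ a ⟩ 0ₑ  0ₑ 0ₑ 1ₑ  0ₑ 1ₑ 0ₑ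
  r₁⁻ a = sparse 1ₑ 0ₑ ⟨ a ⟩  0ₑ 0ₑ 1ₑ  0ₑ 1ₑ 0ₑ
  r₂  a = sparse 0ₑ 1ₑ ⟨ a ⟩  1ₑ 0ₑ 0ₑ  0ₑ 0ₑ 1ₑ
  r₂⁻ a = sparse 0ₑ 1ₑ 0ₑ  1ₑ 0ₑ ⟨ a ⟩  0ₑ 0ₑ 1ₑ

  σ σ⁻¹ : SparseMatrix
  σ   = sparse 0ₑ 1ₑ 0ₑ  0ₑ 0ₑ 1ₑ  1ₑ 0ₑ 0ₑ
  σ⁻¹ = sparse 0ₑ 0ₑ 1ₑ  1ₑ 0ₑ 0ₑ  0ₑ 1ₑ 0ₑ

  private
    x+y≈0⇒y+x≈0 : ∀ {x y} → x + y ≈ 0# → y + x ≈ 0#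
    x+y≈0⇒y+x≈0 x+y≈0 = R.trans (R.+-comm _ _) x+y≈0

  q₁-inverse : ∀ {a a′ b b′} → a + a′ ≈ 0# → b + b′ ≈ 0# → IsInverseᶠ ⟦ q₁ a b ⟧ₘ ⟦ q₁ a′ b′ ⟧ₘ
  q₁-inverse {a} {a′} {b} {b′} a+a′≈0 b+b′≈0 = sparse-inverse (q₁ a b) (q₁ a′ b′)
    (𝔽.entrywise R.refl R.refl (x+y≈0⇒y+x≈0 a+a′≈0) R.refl R.refl (x+y≈0⇒y+x≈0 b+b′≈0) R.refl R.refl R.refl)
    (𝔽.entrywise R.refl R.refl a+a′≈0 R.refl R.refl b+b′≈0 R.refl R.refl R.refl)

  q₂-inverse : ∀ {a a′ b b′} → a + a′ ≈ 0# → b + b′ ≈ 0# → IsInverseᶠ ⟦ q₂ a b ⟧ₘ ⟦ q₂ a′ b′ ⟧ₘ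
  q₂-inverse {a} {a′} {b} {b′} a+a′≈0 b+b′≈0 = sparse-inverse (q₂ a b) (q₂ a′ b′)
    (𝔽.entrywise R.refl (x+y≈0⇒y+x≈0 a+a′≈0) (x+y≈0⇒y+x≈0 b+b′≈0) R.refl R.refl R.refl R.refl R.refl R.refl)
    (𝔽.entrywise R.refl a+a′≈0 b+b′≈0 R.refl R.refl R.refl R.refl R.refl R.refl)

  r₁-inverse : ∀ {a a′} → a + a′ ≈ 0# → IsInverseᶠ ⟦ r₁ a ⟧ₘ ⟦ r₁⁻ a′ ⟧ₘ
  r₁-inverse {a} {a′} a+a′≈0 = sparse-inverse (r₁ a) (r₁⁻ a′)
    (𝔽.entrywise R.refl R.refl (x+y≈0⇒y+x≈0 a+a′≈0) R.refl R.refl R.refl R.refl R.refl R.refl)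
    (𝔽.entrywise R.refl a+a′≈0 R.refl R.refl R.refl R.refl R.refl R.refl R.refl)

  r₂-inverse : ∀ {a a′} → a + a′ ≈ 0# → IsInverseᶠ ⟦ r₂ a ⟧ₘ ⟦ r₂⁻ a′ ⟧ₘ
  r₂-inverse {a} {a′} a+a′≈0 = sparse-inverse (r₂ a) (r₂⁻ a′)
    (𝔽.entrywise R.refl R.refl (x+y≈0⇒y+x≈0 a+a′≈0) R.refl R.refl R.refl R.refl R.refl R.refl)
    (𝔽.entrywise R.refl R.refl R.refl R.refl R.refl a+a′≈0 R.refl R.refl R.refl)

  σ-inverse : IsInverseᶠ ⟦ σ ⟧ₘ ⟦ σ⁻¹ ⟧ₘ
  σ-inverse = sparse-inverse σ σ⁻¹
    (𝔽.entrywise R.refl R.refl R.refl R.refl R.refl R.refl R.refl R.refl R.refl)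
    (𝔽.entrywise R.refl R.refl R.refl R.refl R.refl R.refl R.refl R.refl R.refl)

  q₁-invertible : ∀ a b → GL3A (constM ⟦ q₁ a b ⟧ₘ)
  q₁-invertible a b = constM-GL3A (q₁-inverse (R.-‿inverseʳ a) (R.-‿inverseʳ b))

  q₂-invertible : ∀ a b → GL3A (constM ⟦ q₂ a b ⟧ₘ)
  q₂-invertible a b = constM-GL3A (q₂-inverse (R.-‿inverseʳ a) (R.-‿inverseʳ b))

  r₁-invertible : ∀ a → GL3A (constM ⟦ r₁ a ⟧ₘ)
  r₁-invertible a = constM-GL3A (r₁-inverse (R.-‿inverseʳ a))

  r₁⁻-invertible : ∀ a → GL3A (constM ⟦ r₁⁻ a ⟧ₘ)
  r₁⁻-invertible a = constM-GL3A (𝔽.IsInverse-sym (r₁-inverse (R.-‿inverseˡ a)))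

  r₂-invertible : ∀ a → GL3A (constM ⟦ r₂ a ⟧ₘ)
  r₂-invertible a = constM-GL3A (r₂-inverse (R.-‿inverseʳ a))

  r₂⁻-invertible : ∀ a → GL3A (constM ⟦ r₂⁻ a ⟧ₘ)
  r₂⁻-invertible a = constM-GL3A (𝔽.IsInverse-sym (r₂-inverse (R.-‿inverseˡ a)))

  σ-invertible : GL3A (constM ⟦ σ ⟧ₘ)
  σ-invertible = constM-GL3A σ-inverse

  σ⁻¹-invertible : GL3A (constM ⟦ σ⁻¹ ⟧ₘ)
  σ⁻¹-invertible = constM-GL3A (𝔽.IsInverse-sym σ-inverse)

  -- Diagonal matrices and the representatives δ·g

  tᵇ : Bool → Poly
  tᵇ false = 1ₚ
  tᵇ true  = tₚ

  diag : (Fin 3 → Bool) → Mat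
  diag d 0F 0F = tᵇ (d 0F)
  diag d 1F 1F = tᵇ (d 1F)
  diag d 2F 2F = tᵇ (d 2F)
  diag d _  _  = []

  d₁ d₂ : Fin 3 → Bool
  d₁ 2F = true
  d₁ _  = false
  d₂ 0F = false
  d₂ _  = true

  δ₁≈diag : δ₁ ≈ᴹ diag d₁
  δ₁≈diag = mat-η (diag d₁)

  δ₂≈diag : δ₂ ≈ᴹ diag d₂
  δ₂≈diag = mat-η (diag d₂)

  diag-· : ∀ d X i j → (diag d · X) i j ≋ tᵇ (d i) *ₚ X i j
  diag-· d X 0F j = ≋-trans (+ₚ-identityʳ _) (+ₚ-identityʳ _)
  diag-· d X 1F j = +ₚ-identityʳ _
  diag-· d X 2F j = ≋-refl

  ·-diag : ∀ d X i j → (X · diag d) i j ≋ X i j *ₚ tᵇ (d j)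
  ·-diag d X i 0F = ≋-trans (+ₚ-cong (+ₚ-cong ≋-refl (*ₚ-zeroʳ (X i 1F))) (*ₚ-zeroʳ (X i 2F)))
                            (≋-trans (+ₚ-identityʳ _) (+ₚ-identityʳ _))
  ·-diag d X i 1F = ≋-trans (+ₚ-cong (+ₚ-cong (*ₚ-zeroʳ (X i 0F)) ≋-refl) (*ₚ-zeroʳ (X i 2F))) (+ₚ-identityʳ _)
  ·-diag d X i 2F = +ₚ-cong (+ₚ-cong (*ₚ-zeroʳ (X i 0F)) (*ₚ-zeroʳ (X i 1F))) ≋-refl

  -- tᵇ b *ₚ const ⟦ e ⟧ in the normal form used by Defs, so that repr d₁ (q₁ a b) is literally the matrix
  -- written in the definition of Q₁, and likewise for the other five families.
  scaledEntry : Bool → Entry → Poly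
  scaledEntry _     0ₑ    = []
  scaledEntry false 1ₑ    = 1ₚ
  scaledEntry false ⟨ x ⟩ = const x
  scaledEntry true  1ₑ    = tₚ
  scaledEntry true  ⟨ x ⟩ = 0# ∷ x ∷ []

  scaledEntry-≋ : ∀ b e → scaledEntry b e ≋ tᵇ b *ₚ const ⟦ e ⟧
  scaledEntry-≋ false e = ≋-sym (≋-trans (*ₚ-identityˡ (const ⟦ e ⟧)) (normal e))
    where
    normal : ∀ e → const ⟦ e ⟧ ≋ scaledEntry false e
    normal 0ₑ    = ≋-sym []≋0∷[]
    normal 1ₑ    = ≋-refl
    normal ⟨ x ⟩ = ≋-refl
  scaledEntry-≋ true e = ≋-sym (≋-trans (tₚ-*ₚ (const ⟦ e ⟧)) (normal e))
    where
    normal : ∀ e → 0# ∷ const ⟦ e ⟧ ≋ scaledEntry true e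
    normal 0ₑ    = ≋-sym (≋-trans []≋0∷[] (∷-cong R.refl []≋0∷[]))
    normal 1ₑ    = ≋-refl
    normal ⟨ x ⟩ = ≋-refl

  repr : (Fin 3 → Bool) → SparseMatrix → Mat
  repr d g i j = scaledEntry (d i) (g i j)

  repr-≈ : ∀ d g → repr d g ≈ᴹ diag d · constM ⟦ g ⟧ₘ
  repr-≈ d g = pointwise λ i j → ≋-trans (scaledEntry-≋ (d i) (g i j)) (≋-sym (diag-· d (constM ⟦ g ⟧ₘ) i j))

  reducedRepr : (Fin 3 → Bool) → SparseMatrix → SparseMatrix
  reducedRepr d g i j = if d i then 0ₑ else g i j

  redM-repr : ∀ d g → redM (repr d g) ≈ᶠ ⟦ reducedRepr d g ⟧ₘ
  redM-repr d g = pointwiseᶠ λ i j → red-scaledEntry (d i) (g i j)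
    where
    red-scaledEntry : ∀ b e → red (scaledEntry b e) ≈ ⟦ if b then 0ₑ else e ⟧
    red-scaledEntry false 0ₑ    = R.refl
    red-scaledEntry false 1ₑ    = R.refl
    red-scaledEntry false ⟨ x ⟩ = R.refl
    red-scaledEntry true  0ₑ    = R.refl
    red-scaledEntry true  1ₑ    = R.refl
    red-scaledEntry true  ⟨ x ⟩ = R.refl

  Q₁-repr : ∀ a b → Q₁ (repr d₁ (q₁ a b))
  Q₁-repr a b = a , b , ≈ᴹ⇒≈mat (repr d₁ (q₁ a b)) ≈ᴹ-refl

  R₁-repr : ∀ a → R₁ (repr d₁ (r₁ a))
  R₁-repr a = a , ≈ᴹ⇒≈mat (repr d₁ (r₁ a)) ≈ᴹ-refl

  S₁-repr : S₁ (repr d₁ σ)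
  S₁-repr = lift (≈ᴹ⇒≈mat (repr d₁ σ) ≈ᴹ-refl)

  Q₂-repr : ∀ a b → Q₂ (repr d₂ (q₂ a b))
  Q₂-repr a b = a , b , ≈ᴹ⇒≈mat (repr d₂ (q₂ a b)) ≈ᴹ-refl

  R₂-repr : ∀ a → R₂ (repr d₂ (r₂ a))
  R₂-repr a = a , ≈ᴹ⇒≈mat (repr d₂ (r₂ a)) ≈ᴹ-refl

  S₂-repr : S₂ (repr d₂ σ⁻¹)
  S₂-repr = lift (≈ᴹ⇒≈mat (repr d₂ σ⁻¹) ≈ᴹ-refl)

  -- Conjugation by diagonal matrices

  Integral : Bool → Bool → Poly → Set ℓ
  Integral false true p = red p ≈ 0#
  Integral _     _    _ = Lift ℓ ⊤

  -- conjₚ (d i) (d j) is the (i, j) entry of diag d · M · diag d⁻¹ in terms of Mᵢⱼ; drop 1 divides by t,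
  -- which is only meaningful under Integral.
  conjₚ : Bool → Bool → Poly → Poly
  conjₚ false false p = p
  conjₚ false true  p = drop 1 p
  conjₚ true  false p = 0# ∷ p
  conjₚ true  true  p = p

  conjₚ-*ₚtᵇ : ∀ b b′ p → Integral b b′ p → conjₚ b b′ p *ₚ tᵇ b′ ≋ tᵇ b *ₚ p
  conjₚ-*ₚtᵇ false false p _    = ≋-trans (*ₚ-identityʳ p) (≋-sym (*ₚ-identityˡ p))
  conjₚ-*ₚtᵇ true  true  p _    = ≋-trans (*ₚ-tₚ p) (≋-sym (tₚ-*ₚ p))
  conjₚ-*ₚtᵇ true  false p _    = ≋-trans (*ₚ-identityʳ (0# ∷ p)) (≋-sym (tₚ-*ₚ p))
  conjₚ-*ₚtᵇ false true  p p≈0 = ≋-trans (*ₚ-tₚ (drop 1 p)) (≋-trans (0∷drop p p≈0) (≋-sym (*ₚ-identityˡ p)))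
    where
    0∷drop : ∀ p → red p ≈ 0# → 0# ∷ drop 1 p ≋ p
    0∷drop []      _    = ≋-sym []≋0∷[]
    0∷drop (x ∷ p) x≈0 = ∷-cong (R.sym x≈0) ≋-refl

  Conjugable : (Fin 3 → Bool) → Mat → Set ℓ
  Conjugable d M = ∀ i j → Integral (d i) (d j) (M i j)

  conj : (Fin 3 → Bool) → Mat → Mat
  conj d M i j = conjₚ (d i) (d j) (M i j)

  conj-·diag : ∀ d {M} → Conjugable d M → conj d M · diag d ≈ᴹ diag d · M
  conj-·diag d {M} M-conj = pointwise λ i j →
    ≋-trans (·-diag d (conj d M) i j) (≋-trans (conjₚ-*ₚtᵇ (d i) (d j) (M i j) (M-conj i j)) (≋-sym (diag-· d M i j)))

  ·diag-cancel : ∀ d {X Y} → X · diag d ≈ᴹ Y · diag d → X ≈ᴹ Y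
  ·diag-cancel d {X} {Y} XD≈YD = pointwise λ i j →
    *ₚtᵇ-cancel (d j) (≋-trans (≋-sym (·-diag d X i j)) (≋-trans (at XD≈YD i j) (·-diag d Y i j)))
    where
    *ₚtᵇ-cancel : ∀ b {p q} → p *ₚ tᵇ b ≋ q *ₚ tᵇ b → p ≋ q
    *ₚtᵇ-cancel false {p} {q} p≋q = ≋-trans (≋-sym (*ₚ-identityʳ p)) (≋-trans p≋q (*ₚ-identityʳ q))
    *ₚtᵇ-cancel true  {p} {q} pt≋qt = proj₂ (∷-injective (≋-trans (≋-sym (*ₚ-tₚ p)) (≋-trans pt≋qt (*ₚ-tₚ q))))

  conj-inverse : ∀ d {M K} → Conjugable d M → Conjugable d K → M · K ≈ᴹ 𝔸.𝟙 → conj d M · conj d K ≈ᴹ 𝔸.𝟙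
  conj-inverse d {M} {K} M-conj K-conj MK≈𝟙 = ·diag-cancel d (begin
    conj d M · conj d K · diag d    ≈⟨ ·-assoc (conj d M) (conj d K) (diag d) ⟩
    conj d M · (conj d K · diag d)  ≈⟨ ·-congˡ (conj d M) (conj-·diag d K-conj) ⟩
    conj d M · (diag d · K)         ≈⟨ ·-assoc (conj d M) (diag d) K ⟨
    conj d M · diag d · K           ≈⟨ ·-congʳ K (conj-·diag d M-conj) ⟩
    diag d · M · K                  ≈⟨ ·-assoc (diag d) M K ⟩
    diag d · (M · K)                ≈⟨ ·-congˡ (diag d) MK≈𝟙 ⟩
    diag d · 𝔸.𝟙                    ≈⟨ ·-identityʳ (diag d) ⟩
    diag d                          ≈⟨ ·-identityˡ (diag d) ⟨
    𝔸.𝟙 · diag d                    ∎)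
    where open SetoidReasoning ≈ᴹ-setoid

  conjugable-d₁ : ∀ {M} → red (M 0F 2F) ≈ 0# → red (M 1F 2F) ≈ 0# → Conjugable d₁ M
  conjugable-d₁ M₀₂≈0 M₁₂≈0 = λ where
    0F 0F → lift tt ; 0F 1F → lift tt ; 0F 2F → M₀₂≈0
    1F 0F → lift tt ; 1F 1F → lift tt ; 1F 2F → M₁₂≈0
    2F 0F → lift tt ; 2F 1F → lift tt ; 2F 2F → lift tt

  conjugable-d₂ : ∀ {M} → red (M 0F 1F) ≈ 0# → red (M 0F 2F) ≈ 0# → Conjugable d₂ M
  conjugable-d₂ M₀₁≈0 M₀₂≈0 = λ where
    0F 0F → lift tt ; 0F 1F → M₀₁≈0 ; 0F 2F → M₀₂≈0
    1F 0F → lift tt ; 1F 1F → lift tt ; 1F 2F → lift tt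
    2F 0F → lift tt ; 2F 1F → lift tt ; 2F 2F → lift tt

  InverseClosed : (Fin 3 → Bool) → Set (c ⊔ ℓ)
  InverseClosed d = ∀ {M K} → IsInverse M K → Conjugable d M → Conjugable d K

  d₁-inverseClosed : InverseClosed d₁
  d₁-inverseClosed {M} {K} M-inv M-conj =
    let K₀₂≈0 , K₁₂≈0 = lastColumn-inverse (redM M) (redM K) (inverseˡᶠ (redM-IsInverse M-inv))
                                           (M-conj 0F 2F) (M-conj 1F 2F)
    in conjugable-d₁ K₀₂≈0 K₁₂≈0

  d₂-inverseClosed : InverseClosed d₂
  d₂-inverseClosed {M} {K} M-inv M-conj =
    let K₀₁≈0 , K₀₂≈0 = firstRow-inverse (redM M) (redM K) (inverseʳᶠ (redM-IsInverse M-inv))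
                                         (M-conj 0F 1F) (M-conj 0F 2F)
    in conjugable-d₂ K₀₁≈0 K₀₂≈0

  conjugable-d₁-by-column : ∀ {γ N} → IsInverse γ N → ∀ H {w} → (∀ k → H k 2F ≈ red (N k 2F) * w) →
    Conjugable d₁ (γ · constM H)
  conjugable-d₁-by-column {γ} {N} γ-inv H {w} H≈Nw =
    conjugable-d₁ (R.trans (column 0F) (R.zeroˡ w)) (R.trans (column 1F) (R.zeroˡ w))
    where
    column : ∀ i → red ((γ · constM H) i 2F) ≈ 𝟏 i 2F * w
    column i = begin
      red ((γ · constM H) i 2F)   ≈⟨ atᶠ (redM-· γ (constM H)) i 2F ⟩
      (redM γ ⊙ H) i 2F           ≈⟨ 𝔽.⊗-columnʳ (redM γ) H (redM N) H≈Nw i ⟩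
      (redM γ ⊙ redM N) i 2F * w  ≈⟨ R.*-congʳ (atᶠ (inverseʳᶠ (redM-IsInverse γ-inv)) i 2F) ⟩
      𝟏 i 2F * w                  ∎
      where open SetoidReasoning R.setoid

  conjugable-d₂-by-row : ∀ γ {G H} → IsInverseᶠ G H → ∀ {w} → (∀ k → red (γ 0F k) ≈ w * G 0F k) →
    Conjugable d₂ (γ · constM H)
  conjugable-d₂-by-row γ {G} {H} G-inv {w} γ≈wG =
    conjugable-d₂ (R.trans (row 1F) (R.zeroʳ w)) (R.trans (row 2F) (R.zeroʳ w))
    where
    row : ∀ j → red ((γ · constM H) 0F j) ≈ w * 𝟏 0F j
    row j = begin
      red ((γ · constM H) 0F j)  ≈⟨ atᶠ (redM-· γ (constM H)) 0F j ⟩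
      (redM γ ⊙ H) 0F j          ≈⟨ 𝔽.⊗-rowˡ (redM γ) G H γ≈wG j ⟩
      w * (G ⊙ H) 0F j           ≈⟨ R.*-congˡ (atᶠ (inverseʳᶠ G-inv) 0F j) ⟩
      w * 𝟏 0F j                 ∎
      where open SetoidReasoning R.setoid

  -- The groups Γ

  ConjStable : (Fin 3 → Bool) → Pred Mat (c ⊔ ℓ) → Set (c ⊔ ℓ)
  ConjStable d Γ = ∀ {M} → Γ M → GL3A (conj d M) → Γ (conj d M)

  record Admissible (Γ : Pred Mat (c ⊔ ℓ)) : Set (c ⊔ ℓ) where
    field
      ⊆GL3A    : ∀ {M} → Γ M → GL3A M
      I₃∈      : Γ I₃
      ·∈       : ∀ {M N} → Γ M → Γ N → Γ (M · N)
      conj-d₁∈ : ConjStable d₁ Γ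
      conj-d₂∈ : ConjStable d₂ Γ

  GL3A-admissible : Admissible GL3A
  GL3A-admissible = record
    { ⊆GL3A = λ M∈GL → M∈GL ; I₃∈ = IsInverse⇒GL3A IsInverse-I₃ ; ·∈ = λ {M} {N} → GL3A-· M N
    ; conj-d₁∈ = λ _ h∈GL → h∈GL ; conj-d₂∈ = λ _ h∈GL → h∈GL }

  record MonoidClosed (P : Pred FMatrix ℓ) : Set (c ⊔ ℓ) where
    field
      resp : ∀ {A B} → A ≈ᶠ B → P A → P B
      𝟏∈   : P 𝟏
      ⊙∈   : ∀ {A B} → P A → P B → P (A ⊙ B)

  preimage : Pred FMatrix ℓ → Pred Mat (c ⊔ ℓ)
  preimage P M = GL3A M × P (redM M)

  preimage-admissible : ∀ {P} → MonoidClosed P →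
    (∀ {M} → P (redM M) → P (redM (conj d₁ M))) → (∀ {M} → P (redM M) → P (redM (conj d₂ M))) →
    Admissible (preimage P)
  preimage-admissible {P} P-closed conj-d₁ conj-d₂ = record
    { ⊆GL3A = proj₁
    ; I₃∈ = IsInverse⇒GL3A IsInverse-I₃ , resp (𝔽.≈ᴹ-sym redM-I₃) 𝟏∈
    ; ·∈ = λ {M} {N} (M∈GL , M∈P) (N∈GL , N∈P) → GL3A-· M N M∈GL N∈GL , resp (𝔽.≈ᴹ-sym (redM-· M N)) (⊙∈ M∈P N∈P)
    ; conj-d₁∈ = λ (_ , M∈P) h∈GL → h∈GL , conj-d₁ M∈P
    ; conj-d₂∈ = λ (_ , M∈P) h∈GL → h∈GL , conj-d₂ M∈P }
    where open MonoidClosed P-closed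

  InU InB InP₀ InP₂ : Pred FMatrix ℓ
  InU  A = (A 1F 0F ≈ 0#) × (A 2F 0F ≈ 0#) × (A 2F 1F ≈ 0#) × (A 0F 0F ≈ 1#) × (A 1F 1F ≈ 1#) × (A 2F 2F ≈ 1#)
  InB  A = (A 1F 0F ≈ 0#) × (A 2F 0F ≈ 0#) × (A 2F 1F ≈ 0#)
  InP₀ A = (A 2F 0F ≈ 0#) × (A 2F 1F ≈ 0#)
  InP₂ A = (A 1F 0F ≈ 0#) × (A 2F 0F ≈ 0#)

  private
    _⟨≈⟩_ : ∀ {A B : FMatrix} {i j x} → A ≈ᶠ B → A i j ≈ x → B i j ≈ x
    _⟨≈⟩_ {i = i} {j} A≈B Aᵢⱼ≈x = R.trans (R.sym (atᶠ A≈B i j)) Aᵢⱼ≈x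

    x≈1⇒y≈1⇒x*y≈1 : ∀ {x y} → x ≈ 1# → y ≈ 1# → x * y ≈ 1#
    x≈1⇒y≈1⇒x*y≈1 x≈1 y≈1 = R.trans (R.*-cong x≈1 y≈1) (R.*-identityˡ 1#)

  InP₀-closed : MonoidClosed InP₀
  InP₀-closed = record
    { resp = λ A≈B (A₂₀ , A₂₁) → A≈B ⟨≈⟩ A₂₀ , A≈B ⟨≈⟩ A₂₁
    ; 𝟏∈ = R.refl , R.refl
    ; ⊙∈ = λ {A} {B} (A₂₀ , A₂₁) (B₂₀ , B₂₁) →
        R.trans (𝔽.⊗-only₂ A B (x≈0⇒x*y≈0 _ A₂₀) (x≈0⇒x*y≈0 _ A₂₁)) (y≈0⇒x*y≈0 _ B₂₀) ,
        R.trans (𝔽.⊗-only₂ A B (x≈0⇒x*y≈0 _ A₂₀) (x≈0⇒x*y≈0 _ A₂₁)) (y≈0⇒x*y≈0 _ B₂₁) }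

  InP₂-closed : MonoidClosed InP₂
  InP₂-closed = record
    { resp = λ A≈B (A₁₀ , A₂₀) → A≈B ⟨≈⟩ A₁₀ , A≈B ⟨≈⟩ A₂₀
    ; 𝟏∈ = R.refl , R.refl
    ; ⊙∈ = λ {A} {B} (A₁₀ , A₂₀) (B₁₀ , B₂₀) →
        R.trans (𝔽.⊗-only₀ A B (y≈0⇒x*y≈0 _ B₁₀) (y≈0⇒x*y≈0 _ B₂₀)) (x≈0⇒x*y≈0 _ A₁₀) ,
        R.trans (𝔽.⊗-only₀ A B (y≈0⇒x*y≈0 _ B₁₀) (y≈0⇒x*y≈0 _ B₂₀)) (x≈0⇒x*y≈0 _ A₂₀) }

  InB-closed : MonoidClosed InB
  InB-closed = record
    { resp = λ A≈B (A₁₀ , A₂₀ , A₂₁) → A≈B ⟨≈⟩ A₁₀ , A≈B ⟨≈⟩ A₂₀ , A≈B ⟨≈⟩ A₂₁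
    ; 𝟏∈ = R.refl , R.refl , R.refl
    ; ⊙∈ = λ {A} {B} (A₁₀ , A₂₀ , A₂₁) (B₁₀ , B₂₀ , B₂₁) →
        proj₁ (⊙∈ InP₂-closed {A} {B} (A₁₀ , A₂₀) (B₁₀ , B₂₀)) , ⊙∈ InP₀-closed {A} {B} (A₂₀ , A₂₁) (B₂₀ , B₂₁) }
    where open MonoidClosed

  InU-closed : MonoidClosed InU
  InU-closed = record
    { resp = λ A≈B (A₁₀ , A₂₀ , A₂₁ , A₀₀ , A₁₁ , A₂₂) →
        A≈B ⟨≈⟩ A₁₀ , A≈B ⟨≈⟩ A₂₀ , A≈B ⟨≈⟩ A₂₁ , A≈B ⟨≈⟩ A₀₀ , A≈B ⟨≈⟩ A₁₁ , A≈B ⟨≈⟩ A₂₂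
    ; 𝟏∈ = R.refl , R.refl , R.refl , R.refl , R.refl , R.refl
    ; ⊙∈ = λ {A} {B} (A₁₀ , A₂₀ , A₂₁ , A₀₀ , A₁₁ , A₂₂) (B₁₀ , B₂₀ , B₂₁ , B₀₀ , B₁₁ , B₂₂) →
        let C₁₀ , C₂₀ , C₂₁ = MonoidClosed.⊙∈ InB-closed {A} {B} (A₁₀ , A₂₀ , A₂₁) (B₁₀ , B₂₀ , B₂₁) in
        C₁₀ , C₂₀ , C₂₁ ,
        R.trans (𝔽.⊗-only₀ A B (y≈0⇒x*y≈0 _ B₁₀) (y≈0⇒x*y≈0 _ B₂₀)) (x≈1⇒y≈1⇒x*y≈1 A₀₀ B₀₀) ,
        R.trans (𝔽.⊗-only₁ A B (x≈0⇒x*y≈0 _ A₁₀) (y≈0⇒x*y≈0 _ B₂₁)) (x≈1⇒y≈1⇒x*y≈1 A₁₁ B₁₁) ,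
        R.trans (𝔽.⊗-only₂ A B (x≈0⇒x*y≈0 _ A₂₀) (x≈0⇒x*y≈0 _ A₂₁)) (x≈1⇒y≈1⇒x*y≈1 A₂₂ B₂₂) }

  Γ₁-admissible : Admissible Γ₁
  Γ₁-admissible = preimage-admissible InU-closed
    (λ (C₁₀ , _ , _ , C₀₀ , C₁₁ , C₂₂) → C₁₀ , R.refl , R.refl , C₀₀ , C₁₁ , C₂₂)
    (λ (_ , _ , C₂₁ , C₀₀ , C₁₁ , C₂₂) → R.refl , R.refl , C₂₁ , C₀₀ , C₁₁ , C₂₂)

  Γ₀-admissible : Admissible Γ₀
  Γ₀-admissible = preimage-admissible InB-closed
    (λ (C₁₀ , _ , _) → C₁₀ , R.refl , R.refl)
    (λ (_ , _ , C₂₁) → R.refl , R.refl , C₂₁)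

  ΓP₀-admissible : Admissible ΓP₀
  ΓP₀-admissible = preimage-admissible InP₀-closed
    (λ _ → R.refl , R.refl)
    (λ (_ , C₂₁) → R.refl , C₂₁)

  ΓP₂-admissible : Admissible ΓP₂
  ΓP₂-admissible = preimage-admissible InP₂-closed
    (λ (C₁₀ , _) → C₁₀ , R.refl)
    (λ _ → R.refl , R.refl)

  -- Existence of representatives

  Covered : Pred Mat (c ⊔ ℓ) → Mat → Pred Mat (c ⊔ ℓ) → Mat → Set (c ⊔ ℓ)
  Covered Γ δ S γ′ = ∃[ s ] (S s × ∃[ h ] (Γ h × δ · γ′ ≈ᴹ h · s))

  module _ {Γ : Pred Mat (c ⊔ ℓ)} (Γ-admissible : Admissible Γ) where
    open Admissible Γ-admissible

    coset-factorisation : ∀ d → InverseClosed d → ConjStable d Γ → ∀ {γ′} g g⁻¹ → Γ γ′ →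
      IsInverseᶠ ⟦ g ⟧ₘ ⟦ g⁻¹ ⟧ₘ → Γ (constM ⟦ g⁻¹ ⟧ₘ) → Conjugable d (γ′ · constM ⟦ g⁻¹ ⟧ₘ) →
      ∃[ h ] (Γ h × diag d · γ′ ≈ᴹ h · repr d g)
    coset-factorisation d closed conj∈ {γ′} g g⁻¹ γ′∈Γ g-inv g⁻¹∈Γ M-conj =
      conj d M , conj∈ (·∈ γ′∈Γ g⁻¹∈Γ) (IsInverse⇒GL3A h-inv) , factorisation
      where
      G G⁻¹ N M K : Mat
      G   = constM ⟦ g ⟧ₘ
      G⁻¹ = constM ⟦ g⁻¹ ⟧ₘ
      N   = proj₁ (⊆GL3A γ′∈Γ)
      M   = γ′ · G⁻¹
      K   = G · N

      M-inv : IsInverse M K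
      M-inv = IsInverse-⊗ (GL3A⇒IsInverse γ′ (⊆GL3A γ′∈Γ)) (IsInverse-sym (constM-IsInverse g-inv))

      K-conj : Conjugable d K
      K-conj = closed M-inv M-conj

      h-inv : IsInverse (conj d M) (conj d K)
      h-inv = record
        { inverseʳ = conj-inverse d M-conj K-conj (inverseʳ M-inv)
        ; inverseˡ = conj-inverse d K-conj M-conj (inverseˡ M-inv) }

      factorisation : diag d · γ′ ≈ᴹ conj d M · repr d g
      factorisation = ≈ᴹ-sym (begin
        conj d M · repr d g        ≈⟨ ·-congˡ (conj d M) (repr-≈ d g) ⟩
        conj d M · (diag d · G)    ≈⟨ ·-assoc (conj d M) (diag d) G ⟨
        conj d M · diag d · G      ≈⟨ ·-congʳ G (conj-·diag d M-conj) ⟩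
        diag d · M · G             ≈⟨ ·-assoc (diag d) M G ⟩
        diag d · (M · G)           ≈⟨ ·-congˡ (diag d) (·-assoc γ′ G⁻¹ G) ⟩
        diag d · (γ′ · (G⁻¹ · G))  ≈⟨ ·-congˡ (diag d) (·-congˡ γ′ (inverseˡ (constM-IsInverse g-inv))) ⟩
        diag d · (γ′ · 𝔸.𝟙)        ≈⟨ ·-congˡ (diag d) (·-identityʳ γ′) ⟩
        diag d · γ′                ∎)
        where open SetoidReasoning ≈ᴹ-setoid

  module Cover {Γ : Pred Mat (c ⊔ ℓ)} (Γ-admissible : Admissible Γ) {γ′} (γ′∈Γ : Γ γ′) where
    open Admissible Γ-admissible

    N : Mat
    N = proj₁ (⊆GL3A γ′∈Γ)

    γ′-inverse : IsInverse γ′ N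
    γ′-inverse = GL3A⇒IsInverse γ′ (⊆GL3A γ′∈Γ)

    C : FMatrix
    C = redM γ′

    C-inverse : IsInverseᶠ C (redM N)
    C-inverse = redM-IsInverse γ′-inverse

    v : Fin 3 → Carrier
    v k = red (N k 2F)

    v₂*C₂₂≈1 : C 2F 0F ≈ 0# → C 2F 1F ≈ 0# → v 2F * C 2F 2F ≈ 1#
    v₂*C₂₂≈1 C₂₀≈0 C₂₁≈0 = R.trans (R.*-comm _ _) (R.trans
      (R.sym (𝔽.⊗-only₂ C (redM N) (x≈0⇒x*y≈0 (v 0F) C₂₀≈0) (x≈0⇒x*y≈0 (v 1F) C₂₁≈0)))
      (atᶠ (inverseʳᶠ C-inverse) 2F 2F))

    C₂₀*v₀≈1 : v 1F ≈ 0# → v 2F ≈ 0# → C 2F 0F * v 0F ≈ 1#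
    C₂₀*v₀≈1 v₁≈0 v₂≈0 = R.trans
      (R.sym (𝔽.⊗-only₀ C (redM N) (y≈0⇒x*y≈0 (C 2F 1F) v₁≈0) (y≈0⇒x*y≈0 (C 2F 2F) v₂≈0)))
      (atᶠ (inverseʳᶠ C-inverse) 2F 2F)

    C₀₀*N₀₀≈1 : C 1F 0F ≈ 0# → C 2F 0F ≈ 0# → C 0F 0F * red (N 0F 0F) ≈ 1#
    C₀₀*N₀₀≈1 C₁₀≈0 C₂₀≈0 = R.trans (R.*-comm _ _) (R.trans
      (R.sym (𝔽.⊗-only₀ (redM N) C (y≈0⇒x*y≈0 (red (N 0F 1F)) C₁₀≈0) (y≈0⇒x*y≈0 (red (N 0F 2F)) C₂₀≈0)))
      (atᶠ (inverseˡᶠ C-inverse) 0F 0F))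

    covered-by-repr : ∀ {δ d S} g → S (repr d g) → δ ≈ᴹ diag d → ∃[ h ] (Γ h × diag d · γ′ ≈ᴹ h · repr d g) →
      Covered Γ δ S γ′
    covered-by-repr g s∈S δ≈diag (h , h∈Γ , δγ′≈hs) =
      repr _ g , s∈S , h , h∈Γ , ≈ᴹ-trans (·-congʳ γ′ δ≈diag) δγ′≈hs

    cover-by-column : ∀ {S} g g⁻¹ → S (repr d₁ g) → IsInverseᶠ ⟦ g ⟧ₘ ⟦ g⁻¹ ⟧ₘ → Γ (constM ⟦ g⁻¹ ⟧ₘ) →
      ∀ w → (∀ k → ⟦ g⁻¹ ⟧ₘ k 2F ≈ v k * w) → Covered Γ δ₁ S γ′
    cover-by-column g g⁻¹ s∈S g-inv g⁻¹∈Γ w column = covered-by-repr g s∈S δ₁≈diag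
      (coset-factorisation Γ-admissible d₁ d₁-inverseClosed conj-d₁∈ g g⁻¹ γ′∈Γ g-inv g⁻¹∈Γ
        (conjugable-d₁-by-column γ′-inverse ⟦ g⁻¹ ⟧ₘ column))

    cover-by-row : ∀ {S} g g⁻¹ → S (repr d₂ g) → IsInverseᶠ ⟦ g ⟧ₘ ⟦ g⁻¹ ⟧ₘ → Γ (constM ⟦ g⁻¹ ⟧ₘ) →
      ∀ w → (∀ k → C 0F k ≈ w * ⟦ g ⟧ₘ 0F k) → Covered Γ δ₂ S γ′
    cover-by-row g g⁻¹ s∈S g-inv g⁻¹∈Γ w row = covered-by-repr g s∈S δ₂≈diag
      (coset-factorisation Γ-admissible d₂ d₂-inverseClosed conj-d₂∈ g g⁻¹ γ′∈Γ g-inv g⁻¹∈Γ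
        (conjugable-d₂-by-row γ′ g-inv row))

    cover-Q₁ : ∀ {S} → (∀ a b → Γ (constM ⟦ q₁ a b ⟧ₘ)) → Q₁ ⊆ S → ∀ {w} → v 2F * w ≈ 1# → Covered Γ δ₁ S γ′
    cover-Q₁ q₁∈Γ Q₁⊆S {w} v₂w≈1 = cover-by-column (q₁ (- x) (- y)) (q₁ x y) (Q₁⊆S (Q₁-repr (- x) (- y)))
      (q₁-inverse (R.-‿inverseˡ x) (R.-‿inverseˡ y)) (q₁∈Γ x y) w column
      where
      x y : Carrier
      x = v 0F * w
      y = v 1F * w
      column : ∀ k → ⟦ q₁ x y ⟧ₘ k 2F ≈ v k * w
      column 0F = R.refl
      column 1F = R.refl
      column 2F = R.sym v₂w≈1

    cover-R₁ : ∀ {S} → (∀ a → Γ (constM ⟦ r₁⁻ a ⟧ₘ)) → R₁ ⊆ S → v 2F ≈ 0# → ∀ {w} → v 1F * w ≈ 1# →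
      Covered Γ δ₁ S γ′
    cover-R₁ r₁⁻∈Γ R₁⊆S v₂≈0 {w} v₁w≈1 = cover-by-column (r₁ (- x)) (r₁⁻ x) (R₁⊆S (R₁-repr (- x)))
      (r₁-inverse (R.-‿inverseˡ x)) (r₁⁻∈Γ x) w column
      where
      x : Carrier
      x = v 0F * w
      column : ∀ k → ⟦ r₁⁻ x ⟧ₘ k 2F ≈ v k * w
      column 0F = R.refl
      column 1F = R.sym v₁w≈1
      column 2F = R.sym (x≈0⇒x*y≈0 w v₂≈0)

    cover-S₁ : ∀ {S} → Γ (constM ⟦ σ⁻¹ ⟧ₘ) → S₁ ⊆ S → v 1F ≈ 0# → v 2F ≈ 0# → ∀ {w} → v 0F * w ≈ 1# →
      Covered Γ δ₁ S γ′
    cover-S₁ σ⁻¹∈Γ S₁⊆S v₁≈0 v₂≈0 {w} v₀w≈1 = cover-by-column σ σ⁻¹ (S₁⊆S S₁-repr) σ-inverse σ⁻¹∈Γ w column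
      where
      column : ∀ k → ⟦ σ⁻¹ ⟧ₘ k 2F ≈ v k * w
      column 0F = R.sym v₀w≈1
      column 1F = R.sym (x≈0⇒x*y≈0 w v₁≈0)
      column 2F = R.sym (x≈0⇒x*y≈0 w v₂≈0)

    cover-Q₂ : ∀ {S} → (∀ a b → Γ (constM ⟦ q₂ a b ⟧ₘ)) → Q₂ ⊆ S → ∀ {w} → C 0F 0F * w ≈ 1# → Covered Γ δ₂ S γ′
    cover-Q₂ q₂∈Γ Q₂⊆S {w} C₀₀w≈1 = cover-by-row (q₂ a b) (q₂ (- a) (- b)) (Q₂⊆S (Q₂-repr a b))
      (q₂-inverse (R.-‿inverseʳ a) (R.-‿inverseʳ b)) (q₂∈Γ (- a) (- b)) (C 0F 0F) row
      where
      a b : Carrier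
      a = w * C 0F 1F
      b = w * C 0F 2F
      row : ∀ k → C 0F k ≈ C 0F 0F * ⟦ q₂ a b ⟧ₘ 0F k
      row 0F = R.sym (R.*-identityʳ _)
      row 1F = rescale C₀₀w≈1 (C 0F 1F)
      row 2F = rescale C₀₀w≈1 (C 0F 2F)

    cover-R₂ : ∀ {S} → (∀ a → Γ (constM ⟦ r₂⁻ a ⟧ₘ)) → R₂ ⊆ S → C 0F 0F ≈ 0# → ∀ {w} → C 0F 1F * w ≈ 1# →
      Covered Γ δ₂ S γ′
    cover-R₂ r₂⁻∈Γ R₂⊆S C₀₀≈0 {w} C₀₁w≈1 = cover-by-row (r₂ a) (r₂⁻ (- a)) (R₂⊆S (R₂-repr a))
      (r₂-inverse (R.-‿inverseʳ a)) (r₂⁻∈Γ (- a)) (C 0F 1F) row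
      where
      a : Carrier
      a = w * C 0F 2F
      row : ∀ k → C 0F k ≈ C 0F 1F * ⟦ r₂ a ⟧ₘ 0F k
      row 0F = R.trans C₀₀≈0 (R.sym (R.zeroʳ _))
      row 1F = R.sym (R.*-identityʳ _)
      row 2F = rescale C₀₁w≈1 (C 0F 2F)

    cover-S₂ : ∀ {S} → Γ (constM ⟦ σ ⟧ₘ) → S₂ ⊆ S → C 0F 0F ≈ 0# → C 0F 1F ≈ 0# → Covered Γ δ₂ S γ′
    cover-S₂ σ∈Γ S₂⊆S C₀₀≈0 C₀₁≈0 =
      cover-by-row σ⁻¹ σ (S₂⊆S S₂-repr) (𝔽.IsInverse-sym σ-inverse) σ∈Γ (C 0F 2F) row
      where
      row : ∀ k → C 0F k ≈ C 0F 2F * ⟦ σ⁻¹ ⟧ₘ 0F k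
      row 0F = R.trans C₀₀≈0 (R.sym (R.zeroʳ _))
      row 1F = R.trans C₀₁≈0 (R.sym (R.zeroʳ _))
      row 2F = R.sym (R.*-identityʳ _)

    Q₁-covers : (∀ a b → Γ (constM ⟦ q₁ a b ⟧ₘ)) → C 2F 0F ≈ 0# → C 2F 1F ≈ 0# → Covered Γ δ₁ Q₁ γ′
    Q₁-covers q₁∈Γ C₂₀≈0 C₂₁≈0 = cover-Q₁ q₁∈Γ (λ s∈Q₁ → s∈Q₁) (v₂*C₂₂≈1 C₂₀≈0 C₂₁≈0)

    Q₁∪R₁-covers : (∀ a b → Γ (constM ⟦ q₁ a b ⟧ₘ)) → (∀ a → Γ (constM ⟦ r₁⁻ a ⟧ₘ)) → C 2F 0F ≈ 0# →
      Covered Γ δ₁ (Q₁ ∪ R₁) γ′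
    Q₁∪R₁-covers q₁∈Γ r₁⁻∈Γ C₂₀≈0 with unit-or-zero (v 2F) | unit-or-zero (v 1F)
    ... | inj₁ (_ , v₂w≈1) | _                = cover-Q₁ q₁∈Γ inj₁ v₂w≈1
    ... | inj₂ v₂≈0        | inj₁ (_ , v₁w≈1) = cover-R₁ r₁⁻∈Γ inj₂ v₂≈0 v₁w≈1
    ... | inj₂ v₂≈0        | inj₂ v₁≈0        =
      1≈0-elim (R.trans (R.sym (C₂₀*v₀≈1 v₁≈0 v₂≈0)) (x≈0⇒x*y≈0 (v 0F) C₂₀≈0))

    Q₁∪R₁∪S₁-covers : (∀ a b → Γ (constM ⟦ q₁ a b ⟧ₘ)) → (∀ a → Γ (constM ⟦ r₁⁻ a ⟧ₘ)) → Γ (constM ⟦ σ⁻¹ ⟧ₘ) →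
      Covered Γ δ₁ ((Q₁ ∪ R₁) ∪ S₁) γ′
    Q₁∪R₁∪S₁-covers q₁∈Γ r₁⁻∈Γ σ⁻¹∈Γ with unit-or-zero (v 2F) | unit-or-zero (v 1F)
    ... | inj₁ (_ , v₂w≈1) | _                = cover-Q₁ q₁∈Γ (λ s∈Q₁ → inj₁ (inj₁ s∈Q₁)) v₂w≈1
    ... | inj₂ v₂≈0        | inj₁ (_ , v₁w≈1) = cover-R₁ r₁⁻∈Γ (λ s∈R₁ → inj₁ (inj₂ s∈R₁)) v₂≈0 v₁w≈1
    ... | inj₂ v₂≈0        | inj₂ v₁≈0        =
      cover-S₁ σ⁻¹∈Γ inj₂ v₁≈0 v₂≈0 (R.trans (R.*-comm _ _) (C₂₀*v₀≈1 v₁≈0 v₂≈0))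

    Q₂-covers : (∀ a b → Γ (constM ⟦ q₂ a b ⟧ₘ)) → C 1F 0F ≈ 0# → C 2F 0F ≈ 0# → Covered Γ δ₂ Q₂ γ′
    Q₂-covers q₂∈Γ C₁₀≈0 C₂₀≈0 = cover-Q₂ q₂∈Γ (λ s∈Q₂ → s∈Q₂) (C₀₀*N₀₀≈1 C₁₀≈0 C₂₀≈0)

    Q₂∪R₂-covers : (∀ a b → Γ (constM ⟦ q₂ a b ⟧ₘ)) → (∀ a → Γ (constM ⟦ r₂⁻ a ⟧ₘ)) →
      C 2F 0F ≈ 0# → C 2F 1F ≈ 0# → Covered Γ δ₂ (Q₂ ∪ R₂) γ′
    Q₂∪R₂-covers q₂∈Γ r₂⁻∈Γ C₂₀≈0 C₂₁≈0 with unit-or-zero (C 0F 0F) | unit-or-zero (C 0F 1F)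
    ... | inj₁ (_ , C₀₀w≈1) | _                 = cover-Q₂ q₂∈Γ inj₁ C₀₀w≈1
    ... | inj₂ C₀₀≈0        | inj₁ (_ , C₀₁w≈1) = cover-R₂ r₂⁻∈Γ inj₂ C₀₀≈0 C₀₁w≈1
    ... | inj₂ C₀₀≈0        | inj₂ C₀₁≈0        =
      ⊥-elim (first-columns-independent C (redM N) (inverseˡᶠ C-inverse) C₀₀≈0 C₂₀≈0 C₀₁≈0 C₂₁≈0)

    Q₂∪R₂∪S₂-covers : (∀ a b → Γ (constM ⟦ q₂ a b ⟧ₘ)) → (∀ a → Γ (constM ⟦ r₂⁻ a ⟧ₘ)) → Γ (constM ⟦ σ ⟧ₘ) →
      Covered Γ δ₂ ((Q₂ ∪ R₂) ∪ S₂) γ′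
    Q₂∪R₂∪S₂-covers q₂∈Γ r₂⁻∈Γ σ∈Γ with unit-or-zero (C 0F 0F) | unit-or-zero (C 0F 1F)
    ... | inj₁ (_ , C₀₀w≈1) | _                 = cover-Q₂ q₂∈Γ (λ s∈Q₂ → inj₁ (inj₁ s∈Q₂)) C₀₀w≈1
    ... | inj₂ C₀₀≈0        | inj₁ (_ , C₀₁w≈1) = cover-R₂ r₂⁻∈Γ (λ s∈R₂ → inj₁ (inj₂ s∈R₂)) C₀₀≈0 C₀₁w≈1
    ... | inj₂ C₀₀≈0        | inj₂ C₀₁≈0        = cover-S₂ σ∈Γ inj₂ C₀₀≈0 C₀₁≈0

  -- Uniqueness of representatives

  Separated : Pred Mat (c ⊔ ℓ) → Set (c ⊔ ℓ)
  Separated S = ∀ {s s′} → S s → S s′ → ∀ γ → s′ ≈ᴹ γ · s → s ≈ᴹ s′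

  Separated-⊆ : ∀ {S T} → S ⊆ T → Separated T → Separated S
  Separated-⊆ S⊆T T-separated s∈S s′∈S = T-separated (S⊆T s∈S) (S⊆T s′∈S)

  Annihilates : SparseMatrix → SparseMatrix → Set ℓ
  Annihilates A K = ⟦ A ⊙ₑ K ⟧ₘ ≈ᶠ 𝟎

  kernel-transfer : ∀ {d g g′ s s′} γ K → s ≈ᴹ repr d g → s′ ≈ᴹ repr d g′ → s′ ≈ᴹ γ · s →
    Annihilates (reducedRepr d g) K → Annihilates (reducedRepr d g′) K
  kernel-transfer {d} {g} {g′} {s} {s′} γ K s≈ s′≈ s′≈γs K-ann = begin
    ⟦ reducedRepr d g′ ⊙ₑ K ⟧ₘ               ≈⟨ ⟦⊙ₑ⟧ (reducedRepr d g′) K ⟩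
    ⟦ reducedRepr d g′ ⟧ₘ ⊙ ⟦ K ⟧ₘ           ≈⟨ 𝔽.⊗-congʳ ⟦ K ⟧ₘ (reduction s′≈) ⟨
    redM s′ ⊙ ⟦ K ⟧ₘ                          ≈⟨ 𝔽.⊗-congʳ ⟦ K ⟧ₘ (𝔽.≈ᴹ-trans (redM-cong s′≈γs) (redM-· γ s)) ⟩
    redM γ ⊙ redM s ⊙ ⟦ K ⟧ₘ                  ≈⟨ 𝔽.⊗-assoc (redM γ) (redM s) ⟦ K ⟧ₘ ⟩
    redM γ ⊙ (redM s ⊙ ⟦ K ⟧ₘ)                ≈⟨ 𝔽.⊗-congˡ (redM γ) (𝔽.⊗-congʳ ⟦ K ⟧ₘ (reduction s≈)) ⟩
    redM γ ⊙ (⟦ reducedRepr d g ⟧ₘ ⊙ ⟦ K ⟧ₘ)  ≈⟨ 𝔽.⊗-congˡ (redM γ) (⟦⊙ₑ⟧ (reducedRepr d g) K) ⟨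
    redM γ ⊙ ⟦ reducedRepr d g ⊙ₑ K ⟧ₘ        ≈⟨ 𝔽.⊗-congˡ (redM γ) K-ann ⟩
    redM γ ⊙ 𝟎                                ≈⟨ 𝔽.⊗-zeroʳ (redM γ) ⟩
    𝟎                                         ∎
    where
    open SetoidReasoning 𝔽.≈ᴹ-setoid
    reduction : ∀ {t h} → t ≈ᴹ repr d h → redM t ≈ᶠ ⟦ reducedRepr d h ⟧ₘ
    reduction {h = h} t≈ = 𝔽.≈ᴹ-trans (redM-cong t≈) (redM-repr d h)

  repr-unique : ∀ {d g g′ s s′} → s ≈ᴹ repr d g → s′ ≈ᴹ repr d g′ → ⟦ g ⟧ₘ ≈ᶠ ⟦ g′ ⟧ₘ → s ≈ᴹ s′
  repr-unique {d} {g} {g′} {s} {s′} s≈ s′≈ g≈g′ = begin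
    s                        ≈⟨ s≈ ⟩
    repr d g                 ≈⟨ repr-≈ d g ⟩
    diag d · constM ⟦ g ⟧ₘ   ≈⟨ ·-congˡ (diag d) (constM-cong g≈g′) ⟩
    diag d · constM ⟦ g′ ⟧ₘ  ≈⟨ repr-≈ d g′ ⟨
    repr d g′                ≈⟨ s′≈ ⟨
    s′                       ∎
    where open SetoidReasoning ≈ᴹ-setoid

  separated : ∀ {I : Set c} d (shape kernel : I → SparseMatrix) →
    (∀ x → Annihilates (reducedRepr d (shape x)) (kernel x)) →
    (∀ x y → Annihilates (reducedRepr d (shape y)) (kernel x) → ⟦ shape x ⟧ₘ ≈ᶠ ⟦ shape y ⟧ₘ) →
    Separated (λ s → ∃[ x ] s ≈ᴹ repr d (shape x))
  separated d shape kernel annihilates separates (x , s≈) (y , s′≈) γ s′≈γs =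
    repr-unique s≈ s′≈ (separates x y (kernel-transfer γ (kernel x) s≈ s′≈ s′≈γs (annihilates x)))

  data Index : Set c where
    Qᵢ : Carrier → Carrier → Index
    Rᵢ : Carrier → Index
    Sᵢ : Index

  shape₁ kernel₁ shape₂ kernel₂ : Index → SparseMatrix
  shape₁ (Qᵢ a b) = q₁ a b
  shape₁ (Rᵢ a)   = r₁ a
  shape₁ Sᵢ       = σ
  kernel₁ (Qᵢ a b) = sparse ⟨ - a ⟩ 0ₑ 0ₑ  ⟨ - b ⟩ 0ₑ 0ₑ  1ₑ 0ₑ 0ₑ
  kernel₁ (Rᵢ a)   = sparse ⟨ - a ⟩ 0ₑ 0ₑ  1ₑ 0ₑ 0ₑ  0ₑ 0ₑ 0ₑ
  kernel₁ Sᵢ       = sparse 1ₑ 0ₑ 0ₑ  0ₑ 0ₑ 0ₑ  0ₑ 0ₑ 0ₑ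
  shape₂ (Qᵢ a b) = q₂ a b
  shape₂ (Rᵢ a)   = r₂ a
  shape₂ Sᵢ       = σ⁻¹
  kernel₂ (Qᵢ a b) = sparse ⟨ - a ⟩ ⟨ - b ⟩ 0ₑ  1ₑ 0ₑ 0ₑ  0ₑ 1ₑ 0ₑ
  kernel₂ (Rᵢ a)   = sparse 1ₑ 0ₑ 0ₑ  0ₑ ⟨ - a ⟩ 0ₑ  0ₑ 1ₑ 0ₑ
  kernel₂ Sᵢ       = sparse 1ₑ 0ₑ 0ₑ  0ₑ 1ₑ 0ₑ  0ₑ 0ₑ 0ₑ

  kernel₁-annihilates : ∀ x → Annihilates (reducedRepr d₁ (shape₁ x)) (kernel₁ x)
  kernel₁-annihilates (Qᵢ a b) =
    𝔽.entrywise (R.-‿inverseˡ a) R.refl R.refl (R.-‿inverseˡ b) R.refl R.refl R.refl R.refl R.refl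
  kernel₁-annihilates (Rᵢ a) =
    𝔽.entrywise (R.-‿inverseˡ a) R.refl R.refl R.refl R.refl R.refl R.refl R.refl R.refl
  kernel₁-annihilates Sᵢ =
    𝔽.entrywise R.refl R.refl R.refl R.refl R.refl R.refl R.refl R.refl R.refl

  kernel₂-annihilates : ∀ x → Annihilates (reducedRepr d₂ (shape₂ x)) (kernel₂ x)
  kernel₂-annihilates (Qᵢ a b) =
    𝔽.entrywise (R.-‿inverseˡ a) (R.-‿inverseˡ b) R.refl R.refl R.refl R.refl R.refl R.refl R.refl
  kernel₂-annihilates (Rᵢ a) =
    𝔽.entrywise R.refl (R.-‿inverseˡ a) R.refl R.refl R.refl R.refl R.refl R.refl R.refl
  kernel₂-annihilates Sᵢ =
    𝔽.entrywise R.refl R.refl R.refl R.refl R.refl R.refl R.refl R.refl R.refl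

  kernel₁-separates : ∀ x y → Annihilates (reducedRepr d₁ (shape₁ y)) (kernel₁ x) → ⟦ shape₁ x ⟧ₘ ≈ᶠ ⟦ shape₁ y ⟧ₘ
  kernel₁-separates (Qᵢ a b) (Qᵢ a′ b′) ann = 𝔽.entrywise R.refl R.refl (-x+y≈0⇒x≈y (atᶠ ann 0F 0F))
    R.refl R.refl (-x+y≈0⇒x≈y (atᶠ ann 1F 0F)) R.refl R.refl R.refl
  kernel₁-separates (Qᵢ a b) (Rᵢ a′)    ann = 1≈0-elim (atᶠ ann 1F 0F)
  kernel₁-separates (Qᵢ a b) Sᵢ         ann = 1≈0-elim (atᶠ ann 1F 0F)
  kernel₁-separates (Rᵢ a)   (Qᵢ a′ b′) ann = 1≈0-elim (atᶠ ann 1F 0F)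
  kernel₁-separates (Rᵢ a)   (Rᵢ a′)    ann = 𝔽.entrywise R.refl (-x+y≈0⇒x≈y (atᶠ ann 0F 0F))
    R.refl R.refl R.refl R.refl R.refl R.refl R.refl
  kernel₁-separates (Rᵢ a)   Sᵢ         ann = 1≈0-elim (atᶠ ann 0F 0F)
  kernel₁-separates Sᵢ       (Qᵢ a′ b′) ann = 1≈0-elim (atᶠ ann 0F 0F)
  kernel₁-separates Sᵢ       (Rᵢ a′)    ann = 1≈0-elim (atᶠ ann 0F 0F)
  kernel₁-separates Sᵢ       Sᵢ         ann = 𝔽.≈ᴹ-refl

  kernel₂-separates : ∀ x y → Annihilates (reducedRepr d₂ (shape₂ y)) (kernel₂ x) → ⟦ shape₂ x ⟧ₘ ≈ᶠ ⟦ shape₂ y ⟧ₘ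
  kernel₂-separates (Qᵢ a b) (Qᵢ a′ b′) ann = 𝔽.entrywise R.refl (-x+y≈0⇒x≈y (atᶠ ann 0F 0F))
    (-x+y≈0⇒x≈y (atᶠ ann 0F 1F)) R.refl R.refl R.refl R.refl R.refl R.refl
  kernel₂-separates (Qᵢ a b) (Rᵢ a′)    ann = 1≈0-elim (atᶠ ann 0F 0F)
  kernel₂-separates (Qᵢ a b) Sᵢ         ann = 1≈0-elim (atᶠ ann 0F 1F)
  kernel₂-separates (Rᵢ a)   (Qᵢ a′ b′) ann = 1≈0-elim (atᶠ ann 0F 0F)
  kernel₂-separates (Rᵢ a)   (Rᵢ a′)    ann = 𝔽.entrywise R.refl R.refl (-x+y≈0⇒x≈y (atᶠ ann 0F 1F))
    R.refl R.refl R.refl R.refl R.refl R.refl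
  kernel₂-separates (Rᵢ a)   Sᵢ         ann = 1≈0-elim (atᶠ ann 0F 1F)
  kernel₂-separates Sᵢ       (Qᵢ a′ b′) ann = 1≈0-elim (atᶠ ann 0F 0F)
  kernel₂-separates Sᵢ       (Rᵢ a′)    ann = 1≈0-elim (atᶠ ann 0F 1F)
  kernel₂-separates Sᵢ       Sᵢ         ann = 𝔽.≈ᴹ-refl

  δ₁-view : (Q₁ ∪ R₁) ∪ S₁ ⊆ λ s → ∃[ x ] s ≈ᴹ repr d₁ (shape₁ x)
  δ₁-view (inj₁ (inj₁ (a , b , s≈))) = Qᵢ a b , ≈mat⇒≈ᴹ (repr d₁ (q₁ a b)) s≈
  δ₁-view (inj₁ (inj₂ (a , s≈)))     = Rᵢ a , ≈mat⇒≈ᴹ (repr d₁ (r₁ a)) s≈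
  δ₁-view (inj₂ (lift s≈))           = Sᵢ , ≈mat⇒≈ᴹ (repr d₁ σ) s≈

  δ₂-view : (Q₂ ∪ R₂) ∪ S₂ ⊆ λ s → ∃[ x ] s ≈ᴹ repr d₂ (shape₂ x)
  δ₂-view (inj₁ (inj₁ (a , b , s≈))) = Qᵢ a b , ≈mat⇒≈ᴹ (repr d₂ (q₂ a b)) s≈
  δ₂-view (inj₁ (inj₂ (a , s≈)))     = Rᵢ a , ≈mat⇒≈ᴹ (repr d₂ (r₂ a)) s≈
  δ₂-view (inj₂ (lift s≈))           = Sᵢ , ≈mat⇒≈ᴹ (repr d₂ σ⁻¹) s≈

  δ₁-separated : Separated ((Q₁ ∪ R₁) ∪ S₁)
  δ₁-separated = Separated-⊆ δ₁-view (separated d₁ shape₁ kernel₁ kernel₁-annihilates kernel₁-separates)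

  δ₂-separated : Separated ((Q₂ ∪ R₂) ∪ S₂)
  δ₂-separated = Separated-⊆ δ₂-view (separated d₂ shape₂ kernel₂ kernel₂-annihilates kernel₂-separates)

  Inside : Pred Mat (c ⊔ ℓ) → Mat → Pred Mat (c ⊔ ℓ) → Set (c ⊔ ℓ)
  Inside Γ δ S = ∀ {s} → S s → ∃[ γ′ ] (Γ γ′ × s ≈ᴹ δ · γ′)

  Inside-∪ : ∀ {Γ} δ {S T : Pred Mat (c ⊔ ℓ)} → Inside Γ δ S → Inside Γ δ T → Inside Γ δ (S ∪ T)
  Inside-∪ δ S-inside T-inside (inj₁ s∈S) = S-inside s∈S
  Inside-∪ δ S-inside T-inside (inj₂ s∈T) = T-inside s∈T

  inside-by-repr : ∀ {Γ : Pred Mat (c ⊔ ℓ)} {δ d} g {s} → δ ≈ᴹ diag d → s ≈ᴹ repr d g → Γ (constM ⟦ g ⟧ₘ) →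
    ∃[ γ′ ] (Γ γ′ × s ≈ᴹ δ · γ′)
  inside-by-repr {d = d} g δ≈diag s≈ g∈Γ =
    constM ⟦ g ⟧ₘ , g∈Γ , ≈ᴹ-trans s≈ (≈ᴹ-trans (repr-≈ d g) (·-congʳ (constM ⟦ g ⟧ₘ) (≈ᴹ-sym δ≈diag)))

  Q₁-inside : ∀ {Γ : Pred Mat (c ⊔ ℓ)} → (∀ a b → Γ (constM ⟦ q₁ a b ⟧ₘ)) → Inside Γ δ₁ Q₁
  Q₁-inside {Γ} q₁∈Γ (a , b , s≈) = inside-by-repr {Γ} (q₁ a b) δ₁≈diag (≈mat⇒≈ᴹ (repr d₁ (q₁ a b)) s≈) (q₁∈Γ a b)

  R₁-inside : ∀ {Γ : Pred Mat (c ⊔ ℓ)} → (∀ a → Γ (constM ⟦ r₁ a ⟧ₘ)) → Inside Γ δ₁ R₁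
  R₁-inside {Γ} r₁∈Γ (a , s≈) = inside-by-repr {Γ} (r₁ a) δ₁≈diag (≈mat⇒≈ᴹ (repr d₁ (r₁ a)) s≈) (r₁∈Γ a)

  S₁-inside : ∀ {Γ : Pred Mat (c ⊔ ℓ)} → Γ (constM ⟦ σ ⟧ₘ) → Inside Γ δ₁ S₁
  S₁-inside {Γ} σ∈Γ (lift s≈) = inside-by-repr {Γ} σ δ₁≈diag (≈mat⇒≈ᴹ (repr d₁ σ) s≈) σ∈Γ

  Q₂-inside : ∀ {Γ : Pred Mat (c ⊔ ℓ)} → (∀ a b → Γ (constM ⟦ q₂ a b ⟧ₘ)) → Inside Γ δ₂ Q₂
  Q₂-inside {Γ} q₂∈Γ (a , b , s≈) = inside-by-repr {Γ} (q₂ a b) δ₂≈diag (≈mat⇒≈ᴹ (repr d₂ (q₂ a b)) s≈) (q₂∈Γ a b)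

  R₂-inside : ∀ {Γ : Pred Mat (c ⊔ ℓ)} → (∀ a → Γ (constM ⟦ r₂ a ⟧ₘ)) → Inside Γ δ₂ R₂
  R₂-inside {Γ} r₂∈Γ (a , s≈) = inside-by-repr {Γ} (r₂ a) δ₂≈diag (≈mat⇒≈ᴹ (repr d₂ (r₂ a)) s≈) (r₂∈Γ a)

  S₂-inside : ∀ {Γ : Pred Mat (c ⊔ ℓ)} → Γ (constM ⟦ σ⁻¹ ⟧ₘ) → Inside Γ δ₂ S₂
  S₂-inside {Γ} σ⁻¹∈Γ (lift s≈) = inside-by-repr {Γ} σ⁻¹ δ₂≈diag (≈mat⇒≈ᴹ (repr d₂ σ⁻¹) s≈) σ⁻¹∈Γ

  isRepSet : ∀ {Γ δ S} → Admissible Γ → Inside Γ δ S → (∀ {γ′} → Γ γ′ → Covered Γ δ S γ′) → Separated S →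
    IsRepSet Γ δ S
  isRepSet {Γ} {δ} {S} Γ-admissible inside cover separated = record
    { inside = λ s s∈S → let γ′ , γ′∈Γ , s≈δγ′ = inside s∈S in
        I₃ , γ′ , I₃∈ , γ′∈Γ , ≈ᴹ⇒≈ₘ (≈ᴹ-trans s≈δγ′ (·-congʳ γ′ (≈ᴹ-sym I₃·δ≈δ)))
    ; cover = λ ξ (γ , γ′ , γ∈Γ , γ′∈Γ , ξ≈γδγ′) → let s , s∈S , h , h∈Γ , δγ′≈hs = cover γ′∈Γ in
        s , s∈S , γ · h , ·∈ γ∈Γ h∈Γ , ≈ᴹ⇒≈ₘ (coset ξ γ γ′ h s (≈ₘ⇒≈ᴹ ξ≈γδγ′) δγ′≈hs)
    ; unique = λ s s′ s∈S s′∈S γ _ s′≈γs → ≈ᴹ⇒≈ₘ (separated s∈S s′∈S γ (≈ₘ⇒≈ᴹ s′≈γs)) }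
    where
    open Admissible Γ-admissible
    I₃·δ≈δ : I₃ · δ ≈ᴹ δ
    I₃·δ≈δ = ≈ᴹ-trans (·-congʳ δ I₃≈𝟙) (·-identityˡ δ)
    coset : ∀ ξ γ γ′ h s → ξ ≈ᴹ γ · δ · γ′ → δ · γ′ ≈ᴹ h · s → ξ ≈ᴹ γ · h · s
    coset ξ γ γ′ h s ξ≈γδγ′ δγ′≈hs = begin
      ξ             ≈⟨ ξ≈γδγ′ ⟩
      γ · δ · γ′    ≈⟨ ·-assoc γ δ γ′ ⟩
      γ · (δ · γ′)  ≈⟨ ·-congˡ γ δγ′≈hs ⟩
      γ · (h · s)   ≈⟨ ·-assoc γ h s ⟨
      γ · h · s     ∎
      where open SetoidReasoning ≈ᴹ-setoid

  Q₁-isRepSet : ∀ {Γ : Pred Mat (c ⊔ ℓ)} → Admissible Γ → (∀ {M} → Γ M → InP₀ (redM M)) →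
    (∀ a b → Γ (constM ⟦ q₁ a b ⟧ₘ)) → IsRepSet Γ δ₁ Q₁
  Q₁-isRepSet {Γ} Γ-admissible Γ⊆P₀ q₁∈Γ = isRepSet Γ-admissible (Q₁-inside q₁∈Γ)
    (λ {γ′} γ′∈Γ → let C₂₀≈0 , C₂₁≈0 = Γ⊆P₀ {γ′} γ′∈Γ in Cover.Q₁-covers Γ-admissible {γ′} γ′∈Γ q₁∈Γ C₂₀≈0 C₂₁≈0)
    (Separated-⊆ (λ s∈Q₁ → inj₁ (inj₁ s∈Q₁)) δ₁-separated)

  Q₂-isRepSet : ∀ {Γ : Pred Mat (c ⊔ ℓ)} → Admissible Γ → (∀ {M} → Γ M → InP₂ (redM M)) →
    (∀ a b → Γ (constM ⟦ q₂ a b ⟧ₘ)) → IsRepSet Γ δ₂ Q₂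
  Q₂-isRepSet {Γ} Γ-admissible Γ⊆P₂ q₂∈Γ = isRepSet Γ-admissible (Q₂-inside q₂∈Γ)
    (λ {γ′} γ′∈Γ → let C₁₀≈0 , C₂₀≈0 = Γ⊆P₂ {γ′} γ′∈Γ in Cover.Q₂-covers Γ-admissible {γ′} γ′∈Γ q₂∈Γ C₁₀≈0 C₂₀≈0)
    (Separated-⊆ (λ s∈Q₂ → inj₁ (inj₁ s∈Q₂)) δ₂-separated)

  Γ₁-δ₁-isRepSet : IsRepSet Γ₁ δ₁ Q₁
  Γ₁-δ₁-isRepSet = Q₁-isRepSet Γ₁-admissible (λ (_ , _ , C₂₀≈0 , C₂₁≈0 , _) → C₂₀≈0 , C₂₁≈0)
    (λ a b → q₁-invertible a b , R.refl , R.refl , R.refl , R.refl , R.refl , R.refl)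

  Γ₀-δ₁-isRepSet : IsRepSet Γ₀ δ₁ Q₁
  Γ₀-δ₁-isRepSet = Q₁-isRepSet Γ₀-admissible (λ (_ , _ , C₂₀≈0 , C₂₁≈0) → C₂₀≈0 , C₂₁≈0)
    (λ a b → q₁-invertible a b , R.refl , R.refl , R.refl)

  ΓP₀-δ₁-isRepSet : IsRepSet ΓP₀ δ₁ Q₁
  ΓP₀-δ₁-isRepSet = Q₁-isRepSet ΓP₀-admissible proj₂ (λ a b → q₁-invertible a b , R.refl , R.refl)

  Γ₁-δ₂-isRepSet : IsRepSet Γ₁ δ₂ Q₂
  Γ₁-δ₂-isRepSet = Q₂-isRepSet Γ₁-admissible (λ (_ , C₁₀≈0 , C₂₀≈0 , _) → C₁₀≈0 , C₂₀≈0)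
    (λ a b → q₂-invertible a b , R.refl , R.refl , R.refl , R.refl , R.refl , R.refl)

  Γ₀-δ₂-isRepSet : IsRepSet Γ₀ δ₂ Q₂
  Γ₀-δ₂-isRepSet = Q₂-isRepSet Γ₀-admissible (λ (_ , C₁₀≈0 , C₂₀≈0 , _) → C₁₀≈0 , C₂₀≈0)
    (λ a b → q₂-invertible a b , R.refl , R.refl , R.refl)

  ΓP₂-δ₂-isRepSet : IsRepSet ΓP₂ δ₂ Q₂
  ΓP₂-δ₂-isRepSet = Q₂-isRepSet ΓP₂-admissible proj₂ (λ a b → q₂-invertible a b , R.refl , R.refl)

  ΓP₂-δ₁-isRepSet : IsRepSet ΓP₂ δ₁ (Q₁ ∪ R₁)
  ΓP₂-δ₁-isRepSet = isRepSet ΓP₂-admissible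
    (Inside-∪ δ₁ (Q₁-inside q₁∈Γ) (R₁-inside (λ a → r₁-invertible a , R.refl , R.refl)))
    (λ {γ′} γ′∈Γ@(_ , _ , C₂₀≈0) → Cover.Q₁∪R₁-covers ΓP₂-admissible {γ′} γ′∈Γ q₁∈Γ r₁⁻∈Γ C₂₀≈0)
    (Separated-⊆ inj₁ δ₁-separated)
    where
    q₁∈Γ : ∀ a b → ΓP₂ (constM ⟦ q₁ a b ⟧ₘ)
    q₁∈Γ a b = q₁-invertible a b , R.refl , R.refl
    r₁⁻∈Γ : ∀ a → ΓP₂ (constM ⟦ r₁⁻ a ⟧ₘ)
    r₁⁻∈Γ a = r₁⁻-invertible a , R.refl , R.refl

  ΓP₀-δ₂-isRepSet : IsRepSet ΓP₀ δ₂ (Q₂ ∪ R₂)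
  ΓP₀-δ₂-isRepSet = isRepSet ΓP₀-admissible
    (Inside-∪ δ₂ (Q₂-inside q₂∈Γ) (R₂-inside (λ a → r₂-invertible a , R.refl , R.refl)))
    (λ {γ′} γ′∈Γ@(_ , C₂₀≈0 , C₂₁≈0) → Cover.Q₂∪R₂-covers ΓP₀-admissible {γ′} γ′∈Γ q₂∈Γ r₂⁻∈Γ C₂₀≈0 C₂₁≈0)
    (Separated-⊆ inj₁ δ₂-separated)
    where
    q₂∈Γ : ∀ a b → ΓP₀ (constM ⟦ q₂ a b ⟧ₘ)
    q₂∈Γ a b = q₂-invertible a b , R.refl , R.refl
    r₂⁻∈Γ : ∀ a → ΓP₀ (constM ⟦ r₂⁻ a ⟧ₘ)
    r₂⁻∈Γ a = r₂⁻-invertible a , R.refl , R.refl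

  GL3A-δ₁-isRepSet : IsRepSet GL3A δ₁ ((Q₁ ∪ R₁) ∪ S₁)
  GL3A-δ₁-isRepSet = isRepSet GL3A-admissible
    (Inside-∪ δ₁ (Inside-∪ δ₁ (Q₁-inside q₁-invertible) (R₁-inside r₁-invertible)) (S₁-inside σ-invertible))
    (λ {γ′} γ′∈GL → Cover.Q₁∪R₁∪S₁-covers GL3A-admissible {γ′} γ′∈GL q₁-invertible r₁⁻-invertible σ⁻¹-invertible)
    δ₁-separated

  GL3A-δ₂-isRepSet : IsRepSet GL3A δ₂ ((Q₂ ∪ R₂) ∪ S₂)
  GL3A-δ₂-isRepSet = isRepSet GL3A-admissible
    (Inside-∪ δ₂ (Inside-∪ δ₂ (Q₂-inside q₂-invertible) (R₂-inside r₂-invertible)) (S₂-inside σ⁻¹-invertible))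
    (λ {γ′} γ′∈GL → Cover.Q₂∪R₂∪S₂-covers GL3A-admissible {γ′} γ′∈GL q₂-invertible r₂⁻-invertible σ-invertible)
    δ₂-separated

proposition4p4 : ∀ {c ℓ : Level} (F : FiniteField c ℓ) → let open GL3 F in
    (IsRepSet Γ₁ δ₁ Q₁ × IsRepSet Γ₀ δ₁ Q₁ × IsRepSet ΓP₀ δ₁ Q₁)
    × (IsRepSet Γ₁ δ₂ Q₂ × IsRepSet Γ₀ δ₂ Q₂ × IsRepSet ΓP₂ δ₂ Q₂)
    × IsRepSet ΓP₂ δ₁ (Q₁ ∪ R₁)
    × IsRepSet ΓP₀ δ₂ (Q₂ ∪ R₂)
    × IsRepSet GL3A δ₁ ((Q₁ ∪ R₁) ∪ S₁)
    × IsRepSet GL3A δ₂ ((Q₂ ∪ R₂) ∪ S₂)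
proposition4p4 F =
    (Γ₁-δ₁-isRepSet , Γ₀-δ₁-isRepSet , ΓP₀-δ₁-isRepSet)
  , (Γ₁-δ₂-isRepSet , Γ₀-δ₂-isRepSet , ΓP₂-δ₂-isRepSet)
  , ΓP₂-δ₁-isRepSet , ΓP₀-δ₂-isRepSet , GL3A-δ₁-isRepSet , GL3A-δ₂-isRepSet
  where open Representatives F
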